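{- Let $p$ be an odd prime and $\mathbb{F}_p=\mathbb{Z}/p\mathbb{Z}$. For $t\in\mathbb{F}_p$, let $N_p(t)$ denote the number of pairs $(x,y)\in(\mathbb{F}_p^*)^2$ satisfying $x+\frac{1}{x}+y+\frac{1}{y}=t$. Then for every $t\in\mathbb{F}_p^*$, $N_p\!\left(\frac{16}{t}\right)=N_p(t)$.
   Context: $\mathbb{F}_p^*$ denotes the nonzero elements of $\mathbb{F}_p$, and $\frac1x$ denotes the multiplicative inverse of $x$ in $\mathbb{F}_p$. -}

module Defs where

open import Data.Nat using (ℕ; zero; suc; _+_; _*_; _%_; NonZero; _≟_)
open import Data.Nat.Primality using (Prime)
open import Data.Fin using (Fin; toℕ)
open import Data.List using (List; []; _∷_; filter; length; allFin; cartesianProduct; map)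
open import Data.Product using (_×_; _,_; proj₁; proj₂)
open import Relation.Nullary using (Dec; yes; no; ¬_)
open import Relation.Nullary.Decidable using (_×-dec_; ¬?)
open import Relation.Binary.PropositionalEquality using (_≡_)

-- Elements of F_p = Z/pZ are represented by residues 0..p-1, i.e. Fin p
-- (via toℕ); arithmetic is done in ℕ and reduced mod p.

-- The multiplicative inverse of x in F_p: the (unique, for p prime and
-- x ≢ 0) residue u < p with x * u ≡ 1 (mod p).  Found by search; returns 0
-- if no inverse exists (never used in that case).
invSearch : (p : ℕ) .{{_ : NonZero p}} → ℕ → List (Fin p) → ℕ
invSearch p x [] = 0
invSearch p x (u ∷ us) with (x * toℕ u) % p ≟ 1
... | yes _ = toℕ u
... | no  _ = invSearch p x us

inv : (p : ℕ) .{{_ : NonZero p}} → ℕ → ℕ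
inv p x = invSearch p x (allFin p)

IsSol : (p : ℕ) .{{_ : NonZero p}} → ℕ → Fin p × Fin p → Set
IsSol p t (x , y) =
  ¬ (toℕ x ≡ 0) × ¬ (toℕ y ≡ 0) ×
  ((toℕ x + inv p (toℕ x) + toℕ y + inv p (toℕ y)) % p ≡ t % p)

isSol? : (p : ℕ) .{{_ : NonZero p}} → (t : ℕ) → (xy : Fin p × Fin p) → Dec (IsSol p t xy)
isSol? p t (x , y) =
  ¬? (toℕ x ≟ 0) ×-dec ¬? (toℕ y ≟ 0) ×-dec
  ((toℕ x + inv p (toℕ x) + toℕ y + inv p (toℕ y)) % p ≟ t % p)

N : (p : ℕ) .{{_ : NonZero p}} → Fin p → ℕ
N p t = length (filter (isSol? p (toℕ t)) (cartesianProduct (allFin p) (allFin p)))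

{-# OPTIONS --safe #-}
-- Put c = (t/2)². With q = x y the equation reads (x + y)(q + 1) = t q, so q ≠ −1, and
-- (x, y) ↦ (q, z) = (x y, (x − y)(q + 1)/(2q)) is a bijection from the solutions onto the points of
-- z² = c − (q + 1)²/q with q ≠ 0, −1; the two points with q = −1 (z² = c) complete them to all q ≠ 0.
-- Parametrizing the conic w² = v² − 4v by v = (q + 1)²/q, w = q − 1/q, their number is
-- ∑ᵥ r(v² − 4v) r(c − v) with r(a) = #{z | z² = a} = 1 + (a/p). By multiplicativity of the Legendre
-- symbol this is #E_c − 1 for the elliptic curve E_c : z² = v (v − 4)(c − v), so N(t) + 3 = #E_c.
-- Finally (v, z) ↦ (k² v, k³ z) with k = 4/t maps E_c onto E_c′, c′ = (8/t)², exchanging the roots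
-- 4 and c; as c′ belongs to 16/t, N(16/t) + 3 = #E_c′ = #E_c = N(t) + 3.
module Submission where

open import Data.Nat using (ℕ; NonZero)
open import Data.Nat.Primality using (Prime)
open import Relation.Binary.PropositionalEquality using (_≡_; _≢_)

module ZMod (p : ℕ) .{{_ : NonZero p}} where
  open import Data.Nat as ℕ using (suc; _∸_; _%_)
  import Data.Nat.Properties as ℕ
  open import Data.Nat.DivMod
  open import Data.Fin using (Fin; toℕ; fromℕ<)
  open import Data.Fin.Properties using (toℕ-injective; toℕ<n; toℕ-fromℕ<)
  open import Data.Integer as ℤ using (ℤ; -[1+_])
  open import Data.Sign as Sign using (Sign)
  open import Data.Bool using (true; false; T)
  open import Data.Maybe using (Maybe; just; nothing)
  open import Data.Product using (_,_)
  open import Relation.Nullary using (yes; no)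
  open import Relation.Binary.PropositionalEquality hiding ([_])
  open import Algebra.Bundles using (CommutativeRing)
  open import Algebra.Structures using (IsCommutativeRing)
  import Algebra.Solver.Ring.AlmostCommutativeRing as ACR

  F : Set
  F = Fin p

  opaque
    [_] : ℕ → F
    [ n ] = fromℕ< (m%n<n n p)

    toℕ-[] : ∀ n → toℕ [ n ] ≡ n % p
    toℕ-[] n = toℕ-fromℕ< (m%n<n n p)

    fromℕ<-%≡[] : ∀ n → fromℕ< (m%n<n n p) ≡ [ n ]
    fromℕ<-%≡[] n = refl

  []-cong : ∀ {m n} → m % p ≡ n % p → [ m ] ≡ [ n ]
  []-cong {m} {n} e = toℕ-injective (trans (toℕ-[] m) (trans e (sym (toℕ-[] n))))

  []-injective : ∀ {m n} → [ m ] ≡ [ n ] → m % p ≡ n % p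
  []-injective {m} {n} e = trans (sym (toℕ-[] m)) (trans (cong toℕ e) (toℕ-[] n))

  []-toℕ : ∀ x → [ toℕ x ] ≡ x
  []-toℕ x = toℕ-injective (trans (toℕ-[] (toℕ x)) (m<n⇒m%n≡m (toℕ<n x)))

  toℕ-[]-% : ∀ n → toℕ [ n ] % p ≡ n % p
  toℕ-[]-% n = trans (cong (_% p) (toℕ-[] n)) (m%n%n≡m%n n p)

  infixl 6 _+_ _-_
  infixl 7 _*_
  infix 8 -_

  _+_ : F → F → F
  x + y = [ toℕ x ℕ.+ toℕ y ]

  _*_ : F → F → F
  x * y = [ toℕ x ℕ.* toℕ y ]

  -_ : F → F
  - x = [ p ∸ toℕ x ]

  _-_ : F → F → F
  x - y = x + - y

  0# 1# : F
  0# = [ 0 ]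
  1# = [ 1 ]

  []-+ : ∀ m n → [ m ] + [ n ] ≡ [ m ℕ.+ n ]
  []-+ m n = []-cong (begin
    (toℕ [ m ] ℕ.+ toℕ [ n ]) % p              ≡⟨ %-distribˡ-+ (toℕ [ m ]) _ p ⟩
    (toℕ [ m ] % p ℕ.+ toℕ [ n ] % p) % p      ≡⟨ cong₂ (λ a b → (a ℕ.+ b) % p) (toℕ-[]-% m) (toℕ-[]-% n) ⟩
    (m % p ℕ.+ n % p) % p                      ≡⟨ %-distribˡ-+ m n p ⟨
    (m ℕ.+ n) % p                              ∎)
    where open ≡-Reasoning

  []-* : ∀ m n → [ m ] * [ n ] ≡ [ m ℕ.* n ]
  []-* m n = []-cong (begin
    (toℕ [ m ] ℕ.* toℕ [ n ]) % p              ≡⟨ %-distribˡ-* (toℕ [ m ]) _ p ⟩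
    (toℕ [ m ] % p ℕ.* (toℕ [ n ] % p)) % p    ≡⟨ cong₂ (λ a b → (a ℕ.* b) % p) (toℕ-[]-% m) (toℕ-[]-% n) ⟩
    (m % p ℕ.* (n % p)) % p                    ≡⟨ %-distribˡ-* m n p ⟨
    (m ℕ.* n) % p                              ∎)
    where open ≡-Reasoning

  -- Each law is transported from ℕ along the surjection [_].
  private
    lift₃ : (f g : F → F → F → F) (f′ g′ : ℕ → ℕ → ℕ → ℕ) →
            (∀ a b c → f [ a ] [ b ] [ c ] ≡ [ f′ a b c ]) →
            (∀ a b c → g [ a ] [ b ] [ c ] ≡ [ g′ a b c ]) →
            (∀ a b c → f′ a b c ≡ g′ a b c) → ∀ x y z → f x y z ≡ g x y z
    lift₃ f g f′ g′ f-[] g-[] law x y z = begin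
      f x y z                         ≡⟨ cong₃ f (sym ([]-toℕ x)) (sym ([]-toℕ y)) (sym ([]-toℕ z)) ⟩
      f [ a ] [ b ] [ c ]             ≡⟨ f-[] a b c ⟩
      [ f′ a b c ]                    ≡⟨ cong [_] (law a b c) ⟩
      [ g′ a b c ]                    ≡⟨ g-[] a b c ⟨
      g [ a ] [ b ] [ c ]             ≡⟨ cong₃ g ([]-toℕ x) ([]-toℕ y) ([]-toℕ z) ⟩
      g x y z                         ∎
      where
      open ≡-Reasoning
      a b c : ℕ
      a = toℕ x
      b = toℕ y
      c = toℕ z
      cong₃ : ∀ (h : F → F → F → F) {x x′ y y′ z z′} → x ≡ x′ → y ≡ y′ → z ≡ z′ → h x y z ≡ h x′ y′ z′
      cong₃ h refl refl refl = refl

  +-assoc : ∀ x y z → (x + y) + z ≡ x + (y + z)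
  +-assoc = lift₃ (λ x y z → (x + y) + z) (λ x y z → x + (y + z)) (λ a b c → (a ℕ.+ b) ℕ.+ c) (λ a b c → a ℕ.+ (b ℕ.+ c))
    (λ a b c → trans (cong (_+ [ c ]) ([]-+ a b)) ([]-+ _ c))
    (λ a b c → trans (cong ([ a ] +_) ([]-+ b c)) ([]-+ a _))
    ℕ.+-assoc

  *-assoc : ∀ x y z → (x * y) * z ≡ x * (y * z)
  *-assoc = lift₃ (λ x y z → (x * y) * z) (λ x y z → x * (y * z)) (λ a b c → (a ℕ.* b) ℕ.* c) (λ a b c → a ℕ.* (b ℕ.* c))
    (λ a b c → trans (cong (_* [ c ]) ([]-* a b)) ([]-* _ c))
    (λ a b c → trans (cong ([ a ] *_) ([]-* b c)) ([]-* a _))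
    ℕ.*-assoc

  *-distribʳ-+ : ∀ x y z → (y + z) * x ≡ y * x + z * x
  *-distribʳ-+ = lift₃ (λ x y z → (y + z) * x) (λ x y z → y * x + z * x) (λ a b c → (b ℕ.+ c) ℕ.* a) (λ a b c → b ℕ.* a ℕ.+ c ℕ.* a)
    (λ a b c → trans (cong (_* [ a ]) ([]-+ b c)) ([]-* _ a))
    (λ a b c → trans (cong₂ _+_ ([]-* b a) ([]-* c a)) ([]-+ _ _))
    ℕ.*-distribʳ-+

  +-comm : ∀ x y → x + y ≡ y + x
  +-comm x y = cong [_] (ℕ.+-comm (toℕ x) (toℕ y))

  *-comm : ∀ x y → x * y ≡ y * x
  *-comm x y = cong [_] (ℕ.*-comm (toℕ x) (toℕ y))

  +-identityˡ : ∀ x → 0# + x ≡ x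
  +-identityˡ x = trans (cong (0# +_) (sym ([]-toℕ x))) (trans ([]-+ 0 (toℕ x)) ([]-toℕ x))

  *-identityˡ : ∀ x → 1# * x ≡ x
  *-identityˡ x = trans (cong (1# *_) (sym ([]-toℕ x))) (trans ([]-* 1 (toℕ x)) (trans (cong [_] (ℕ.*-identityˡ (toℕ x))) ([]-toℕ x)))

  *-identityʳ : ∀ x → x * 1# ≡ x
  *-identityʳ x = trans (*-comm x 1#) (*-identityˡ x)

  -‿inverseʳ : ∀ x → x + - x ≡ 0#
  -‿inverseʳ x = []-cong (begin
    (toℕ x ℕ.+ toℕ [ p ∸ toℕ x ]) % p   ≡⟨ %-distribˡ-+ (toℕ x) _ p ⟩
    (toℕ x % p ℕ.+ toℕ [ p ∸ toℕ x ] % p) % p ≡⟨ cong (λ b → (toℕ x % p ℕ.+ b) % p) (toℕ-[]-% (p ∸ toℕ x)) ⟩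
    (toℕ x % p ℕ.+ (p ∸ toℕ x) % p) % p ≡⟨ %-distribˡ-+ (toℕ x) _ p ⟨
    (toℕ x ℕ.+ (p ∸ toℕ x)) % p          ≡⟨ cong (_% p) (ℕ.m+[n∸m]≡n (ℕ.<⇒≤ (toℕ<n x))) ⟩
    p % p                                ≡⟨ n%n≡0 p ⟩
    0                                    ≡⟨ m<n⇒m%n≡m (ℕ.>-nonZero⁻¹ p) ⟨
    0 % p                                ∎)
    where open ≡-Reasoning

  isCommutativeRing : IsCommutativeRing _≡_ _+_ _*_ -_ 0# 1#
  isCommutativeRing = record
    { isRing = record
      { +-isAbelianGroup = record
        { isGroup = record
          { isMonoid = record
            { isSemigroup = record
              { isMagma = record { isEquivalence = isEquivalence ; ∙-cong = cong₂ _+_ }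
              ; assoc = +-assoc }
            ; identity = +-identityˡ , λ x → trans (+-comm x 0#) (+-identityˡ x) }
          ; inverse = (λ x → trans (+-comm (- x) x) (-‿inverseʳ x)) , -‿inverseʳ
          ; ⁻¹-cong = cong (-_) }
        ; comm = +-comm }
      ; *-cong = cong₂ _*_
      ; *-assoc = *-assoc
      ; *-identity = *-identityˡ , *-identityʳ
      ; distrib = (λ x y z → trans (*-comm x (y + z)) (trans (*-distribʳ-+ x y z) (cong₂ _+_ (*-comm y x) (*-comm z x))))
                , *-distribʳ-+ }
    ; *-comm = *-comm }

  commutativeRing : CommutativeRing _ _
  commutativeRing = record { isCommutativeRing = isCommutativeRing }

  open import Algebra.Properties.Ring (CommutativeRing.ring commutativeRing) public
    using (-‿distribˡ-*; -‿distribʳ-*; -‿involutive; -0#≈0#; -‿+-comm)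

  fromℤ : ℤ → F
  fromℤ (ℤ.+ n)      = [ n ]
  fromℤ -[1+ n ]   = - [ suc n ]

  private
    x+y-x≡y : ∀ x y → x + y - x ≡ y
    x+y-x≡y x y = begin
      x + y - x     ≡⟨ cong (_- x) (+-comm x y) ⟩
      y + x - x     ≡⟨ +-assoc y x (- x) ⟩
      y + (x - x)   ≡⟨ cong (y +_) (-‿inverseʳ x) ⟩
      y + 0#        ≡⟨ +-comm y 0# ⟩
      0# + y        ≡⟨ +-identityˡ y ⟩
      y             ∎
      where open ≡-Reasoning

    fromℤ-neg-ℕ : ∀ n → fromℤ (ℤ.- (ℤ.+ n)) ≡ - [ n ]
    fromℤ-neg-ℕ 0       = sym -0#≈0#
    fromℤ-neg-ℕ (suc n) = refl

    -- m ⊖ n is m ∸ n or the negation of n ∸ m, depending on m <ᵇ n.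
    fromℤ-⊖ : ∀ m n → fromℤ (m ℤ.⊖ n) ≡ [ m ] - [ n ]
    fromℤ-⊖ m n with m ℕ.<ᵇ n in lt
    ... | true  = begin
      fromℤ (ℤ.- (ℤ.+ (n ∸ m)))                  ≡⟨ fromℤ-neg-ℕ (n ∸ m) ⟩
      - [ n ∸ m ]                              ≡⟨ cong (-_) (x+y-x≡y [ m ] [ n ∸ m ]) ⟨
      - ([ m ] + [ n ∸ m ] - [ m ])            ≡⟨ cong (λ k → - (k - [ m ])) ([]-+ m (n ∸ m)) ⟩
      - ([ m ℕ.+ (n ∸ m) ] - [ m ])            ≡⟨ cong (λ k → - ([ k ] - [ m ])) (ℕ.m+[n∸m]≡n (ℕ.<⇒≤ m<n)) ⟩
      - ([ n ] - [ m ])                        ≡⟨ -‿+-comm [ n ] (- [ m ]) ⟨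
      - [ n ] + - - [ m ]                      ≡⟨ cong (- [ n ] +_) (-‿involutive [ m ]) ⟩
      - [ n ] + [ m ]                          ≡⟨ +-comm (- [ n ]) [ m ] ⟩
      [ m ] - [ n ]                            ∎
      where
      open ≡-Reasoning
      m<n : m ℕ.< n
      m<n = ℕ.<ᵇ⇒< m n (subst T (sym lt) _)
    ... | false = begin
      [ m ∸ n ]                    ≡⟨ x+y-x≡y [ n ] [ m ∸ n ] ⟨
      [ n ] + [ m ∸ n ] - [ n ]    ≡⟨ cong (_- [ n ]) ([]-+ n (m ∸ n)) ⟩
      [ n ℕ.+ (m ∸ n) ] - [ n ]    ≡⟨ cong (λ k → [ k ] - [ n ]) (ℕ.m+[n∸m]≡n n≤m) ⟩
      [ m ] - [ n ]                ∎
      where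
      open ≡-Reasoning
      n≤m : n ℕ.≤ m
      n≤m = ℕ.≮⇒≥ (λ m<n → subst T lt (ℕ.<⇒<ᵇ m<n))

    signed : Sign → F → F
    signed Sign.+ x = x
    signed Sign.- x = - x

    fromℤ-◃ : ∀ s n → fromℤ (s ℤ.◃ n) ≡ signed s [ n ]
    fromℤ-◃ Sign.+ 0       = refl
    fromℤ-◃ Sign.+ (suc n) = refl
    fromℤ-◃ Sign.- 0       = sym -0#≈0#
    fromℤ-◃ Sign.- (suc n) = refl

    fromℤ-signAbs : ∀ i → fromℤ i ≡ signed (ℤ.sign i) [ ℤ.∣ i ∣ ]
    fromℤ-signAbs (ℤ.+ n)    = refl
    fromℤ-signAbs -[1+ n ] = refl

    signed-* : ∀ s t x y → signed s x * signed t y ≡ signed (s Sign.* t) (x * y)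
    signed-* Sign.+ Sign.+ x y = refl
    signed-* Sign.+ Sign.- x y = sym (-‿distribʳ-* x y)
    signed-* Sign.- Sign.+ x y = sym (-‿distribˡ-* x y)
    signed-* Sign.- Sign.- x y =
      trans (sym (-‿distribˡ-* x (- y))) (trans (cong (-_) (sym (-‿distribʳ-* x y))) (-‿involutive (x * y)))

  fromℤ-+ : ∀ i j → fromℤ (i ℤ.+ j) ≡ fromℤ i + fromℤ j
  fromℤ-+ (ℤ.+ m)    (ℤ.+ n)    = sym ([]-+ m n)
  fromℤ-+ (ℤ.+ m)    -[1+ n ] = fromℤ-⊖ m (suc n)
  fromℤ-+ -[1+ m ] (ℤ.+ n)    = trans (fromℤ-⊖ n (suc m)) (+-comm [ n ] _)
  fromℤ-+ -[1+ m ] -[1+ n ] = begin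
    - [ suc (suc (m ℕ.+ n)) ]       ≡⟨ cong (λ k → - [ k ]) (ℕ.+-suc (suc m) n) ⟨
    - [ suc m ℕ.+ suc n ]           ≡⟨ cong (-_) ([]-+ (suc m) (suc n)) ⟨
    - ([ suc m ] + [ suc n ])       ≡⟨ -‿+-comm [ suc m ] [ suc n ] ⟨
    - [ suc m ] + - [ suc n ]       ∎
    where open ≡-Reasoning

  fromℤ-* : ∀ i j → fromℤ (i ℤ.* j) ≡ fromℤ i * fromℤ j
  fromℤ-* i j = begin
    fromℤ (s ℤ.◃ ℤ.∣ i ∣ ℕ.* ℤ.∣ j ∣)                   ≡⟨ fromℤ-◃ s _ ⟩
    signed s [ ℤ.∣ i ∣ ℕ.* ℤ.∣ j ∣ ]                    ≡⟨ cong (signed s) ([]-* ℤ.∣ i ∣ ℤ.∣ j ∣) ⟨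
    signed s ([ ℤ.∣ i ∣ ] * [ ℤ.∣ j ∣ ])                ≡⟨ signed-* (ℤ.sign i) (ℤ.sign j) _ _ ⟨
    signed (ℤ.sign i) [ ℤ.∣ i ∣ ] * signed (ℤ.sign j) [ ℤ.∣ j ∣ ] ≡⟨ cong₂ _*_ (fromℤ-signAbs i) (fromℤ-signAbs j) ⟨
    fromℤ i * fromℤ j                                   ∎
    where
    open ≡-Reasoning
    s : Sign
    s = ℤ.sign i Sign.* ℤ.sign j

  fromℤ-neg : ∀ i → fromℤ (ℤ.- i) ≡ - fromℤ i
  fromℤ-neg (ℤ.+ n)    = fromℤ-neg-ℕ n
  fromℤ-neg -[1+ n ] = sym (-‿involutive _)

  fromℤ-homomorphism : ℤ.+-*-rawRing ACR.-Raw-AlmostCommutative⟶ ACR.fromCommutativeRing commutativeRing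
  fromℤ-homomorphism = record
    { ⟦_⟧    = fromℤ
    ; +-homo = fromℤ-+
    ; *-homo = fromℤ-*
    ; -‿homo = fromℤ-neg
    ; 0-homo = refl
    ; 1-homo = refl
    }

  fromℤ-≟ : ∀ i j → Maybe (fromℤ i ≡ fromℤ j)
  fromℤ-≟ i j with i ℤ.≟ j
  ... | yes i≡j = just (cong fromℤ i≡j)
  ... | no _    = nothing

  open import Algebra.Solver.Ring ℤ.+-*-rawRing (ACR.fromCommutativeRing commutativeRing) fromℤ-homomorphism fromℤ-≟ public
    using (Polynomial; solve; _:=_; _:+_; _:*_; _:-_; :-_; con)

  κ : ∀ {m} → ℕ → Polynomial m
  κ k = con (ℤ.+ k)

module Counting (n : ℕ) where
  open import Data.Nat as ℕ using (zero; suc; _+_; _*_; _≤_)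
  import Data.Nat.Properties as ℕ
  open import Data.Fin using (Fin; zero; suc)
  import Data.Fin as Fin
  open import Data.Fin.Properties using (suc-injective)
  open import Data.Product using (_×_; _,_)
  open import Data.Product.Properties using (≡-dec)
  open import Data.Empty using (⊥-elim)
  open import Relation.Nullary using (Dec; yes; no; ¬_)
  open import Relation.Nullary.Decidable using (_×-dec_; ¬?)
  open import Relation.Binary.Definitions using (DecidableEquality)
  open import Data.List as List using (List; []; _∷_; length; filter; cartesianProduct; allFin)
  open import Data.List.Properties using (map-++; map-∘; map-tabulate)
  open import Data.Nat.ListAction using () renaming (sum to sumˡ)
  open import Data.Nat.ListAction.Properties using (sum-++)
  open import Relation.Binary.PropositionalEquality
  open import Algebra.Properties.Semiring.Sum ℕ.+-*-semiring
    using (sum; sum-cong-≗; ∑-distrib-+; *-distribˡ-sum; sum-replicate-zero)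

  𝟙 : ∀ {P : Set} → Dec P → ℕ
  𝟙 (yes _) = 1
  𝟙 (no _)  = 0

  𝟙-yes : ∀ {P : Set} → P → (d : Dec P) → 𝟙 d ≡ 1
  𝟙-yes p (yes _) = refl
  𝟙-yes p (no ¬p) = ⊥-elim (¬p p)

  𝟙-no : ∀ {P : Set} → ¬ P → (d : Dec P) → 𝟙 d ≡ 0
  𝟙-no ¬p (yes p) = ⊥-elim (¬p p)
  𝟙-no ¬p (no _)  = refl

  𝟙-⇔ : ∀ {P Q : Set} → (P → Q) → (Q → P) → (d : Dec P) (e : Dec Q) → 𝟙 d ≡ 𝟙 e
  𝟙-⇔ f g (yes p) e = sym (𝟙-yes (f p) e)
  𝟙-⇔ f g (no ¬p) e = sym (𝟙-no (λ q → ¬p (g q)) e)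

  𝟙-× : ∀ {P Q : Set} (d : Dec P) (e : Dec Q) → 𝟙 (d ×-dec e) ≡ 𝟙 d * 𝟙 e
  𝟙-× (yes _) (yes _) = refl
  𝟙-× (yes _) (no _)  = refl
  𝟙-× (no _)  _       = refl

  infixr 2 _⊗_

  data Shape : Set where
    𝔽   : Shape
    _⊗_ : Shape → Shape → Shape

  El : Shape → Set
  El 𝔽       = Fin n
  El (A ⊗ B) = El A × El B

  ∑ : (A : Shape) → (El A → ℕ) → ℕ
  ∑ 𝔽       f = sum f
  ∑ (A ⊗ B) f = ∑ A λ a → ∑ B λ b → f (a , b)

  ∑-cong : ∀ A {f g : El A → ℕ} → (∀ a → f a ≡ g a) → ∑ A f ≡ ∑ A g
  ∑-cong 𝔽       f≗g = sum-cong-≗ f≗g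
  ∑-cong (A ⊗ B) f≗g = ∑-cong A λ a → ∑-cong B λ b → f≗g (a , b)

  ∑-+ : ∀ A (f g : El A → ℕ) → ∑ A (λ a → f a + g a) ≡ ∑ A f + ∑ A g
  ∑-+ 𝔽       f g = ∑-distrib-+ f g
  ∑-+ (A ⊗ B) f g = trans (∑-cong A λ a → ∑-+ B _ _) (∑-+ A _ _)

  ∑-*ˡ : ∀ A c (f : El A → ℕ) → ∑ A (λ a → c * f a) ≡ c * ∑ A f
  ∑-*ˡ 𝔽       c f = sym (*-distribˡ-sum c f)
  ∑-*ˡ (A ⊗ B) c f = trans (∑-cong A λ a → ∑-*ˡ B c _) (∑-*ˡ A c _)

  ∑-zero : ∀ A → ∑ A (λ _ → 0) ≡ 0
  ∑-zero 𝔽       = sum-replicate-zero n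
  ∑-zero (A ⊗ B) = trans (∑-cong A λ _ → ∑-zero B) (∑-zero A)

  ∑-comm : ∀ A B (f : El A → El B → ℕ) → ∑ A (λ a → ∑ B (f a)) ≡ ∑ B (λ b → ∑ A (λ a → f a b))
  ∑-comm 𝔽       B f = sum-∑-comm f
    where
    sum-∑-comm : ∀ {m} (g : Fin m → El B → ℕ) → sum (λ i → ∑ B (g i)) ≡ ∑ B (λ b → sum (λ i → g i b))
    sum-∑-comm {zero}  g = sym (∑-zero B)
    sum-∑-comm {suc m} g = trans (cong (∑ B (g zero) +_) (sum-∑-comm (λ i → g (suc i)))) (sym (∑-+ B _ _))
  ∑-comm (A ⊗ A′) B f = trans (∑-cong A λ a → ∑-comm A′ B (λ a′ → f (a , a′))) (∑-comm A B _)

  ∑-mono-≤ : ∀ A {f g : El A → ℕ} → (∀ a → f a ≤ g a) → ∑ A f ≤ ∑ A g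
  ∑-mono-≤ 𝔽       f≤g = sum-mono f≤g
    where
    sum-mono : ∀ {m} {f g : Fin m → ℕ} → (∀ i → f i ≤ g i) → sum f ≤ sum g
    sum-mono {zero}  _   = ℕ.z≤n
    sum-mono {suc m} f≤g = ℕ.+-mono-≤ (f≤g zero) (sum-mono (λ i → f≤g (suc i)))
  ∑-mono-≤ (A ⊗ B) f≤g = ∑-mono-≤ A λ a → ∑-mono-≤ B λ b → f≤g (a , b)

  ∑-𝔽-1 : ∑ 𝔽 (λ _ → 1) ≡ n
  ∑-𝔽-1 = sum-1
    where
    sum-1 : ∀ {m} → sum {m} (λ _ → 1) ≡ m
    sum-1 {zero}  = refl
    sum-1 {suc m} = cong suc (sum-1 {m})

  _≟_ : ∀ {A} → DecidableEquality (El A)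
  _≟_ {𝔽}     = Fin._≟_
  _≟_ {A ⊗ B} = ≡-dec (_≟_ {A}) (_≟_ {B})

  ∑-𝟙-≡ : ∀ A (j : El A) → ∑ A (λ a → 𝟙 (_≟_ {A} a j)) ≡ 1
  ∑-𝟙-≡ 𝔽 j = sum-𝟙-≡ j
    where
    sum-𝟙-≡ : ∀ {m} (j : Fin m) → sum (λ i → 𝟙 (i Fin.≟ j)) ≡ 1
    sum-𝟙-≡ {suc m} zero = cong suc (trans (sum-cong-≗ {m} λ i → 𝟙-no (λ ()) (suc i Fin.≟ zero)) (sum-replicate-zero m))
    sum-𝟙-≡ {suc m} (suc j) =
      trans (sum-cong-≗ {m} λ i → 𝟙-⇔ suc-injective (cong suc) (suc i Fin.≟ suc j) (i Fin.≟ j)) (sum-𝟙-≡ j)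
  ∑-𝟙-≡ (A ⊗ B) (j , k) = begin
    ∑ A (λ a → ∑ B λ b → 𝟙 (_≟_ {A ⊗ B} (a , b) (j , k)))
      ≡⟨ (∑-cong A λ a → ∑-cong B λ b → trans (𝟙-⇔ ,-injective (λ (a≡j , b≡k) → cong₂ _,_ a≡j b≡k) _ _) (𝟙-× (_≟_ {A} a j) _)) ⟩
    ∑ A (λ a → ∑ B λ b → 𝟙 (_≟_ {A} a j) * 𝟙 (_≟_ {B} b k))
      ≡⟨ (∑-cong A λ a → trans (∑-*ˡ B (𝟙 (_≟_ {A} a j)) _) (trans (cong (𝟙 (_≟_ {A} a j) *_) (∑-𝟙-≡ B k)) (ℕ.*-identityʳ _))) ⟩
    ∑ A (λ a → 𝟙 (_≟_ {A} a j))
      ≡⟨ ∑-𝟙-≡ A j ⟩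
    1 ∎
    where
    open ≡-Reasoning
    ,-injective : ∀ {a b} → (a , b) ≡ (j , k) → a ≡ j × b ≡ k
    ,-injective refl = refl , refl

  ∑-𝟙-≡-* : ∀ A (j : El A) c → ∑ A (λ a → c * 𝟙 (_≟_ {A} a j)) ≡ c
  ∑-𝟙-≡-* A j c = trans (∑-*ˡ A c _) (trans (cong (c *_) (∑-𝟙-≡ A j)) (ℕ.*-identityʳ c))

  count : ∀ A {P : El A → Set} → (∀ a → Dec (P a)) → ℕ
  count A P? = ∑ A (λ a → 𝟙 (P? a))

  count-⇔ : ∀ A {P Q : El A → Set} (P? : ∀ a → Dec (P a)) (Q? : ∀ a → Dec (Q a)) →
            (∀ a → P a → Q a) → (∀ a → Q a → P a) → count A P? ≡ count A Q?
  count-⇔ A P? Q? f g = ∑-cong A λ a → 𝟙-⇔ (f a) (g a) (P? a) (Q? a)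

  -- Double counting the graph of f restricted to P, which is also the graph of g restricted to Q.
  count-bijection : ∀ A B {P : El A → Set} {Q : El B → Set} (P? : ∀ a → Dec (P a)) (Q? : ∀ b → Dec (Q b))
    (f : El A → El B) (g : El B → El A) →
    (∀ a → P a → Q (f a)) → (∀ b → Q b → P (g b)) →
    (∀ a → P a → g (f a) ≡ a) → (∀ b → Q b → f (g b) ≡ b) →
    count A P? ≡ count B Q?
  count-bijection A B {P} {Q} P? Q? f g f-Q g-P gf fg = begin
    ∑ A (λ a → 𝟙 (P? a))
      ≡⟨ (∑-cong A λ a → sym (∑-𝟙-≡-* B (f a) (𝟙 (P? a)))) ⟩
    ∑ A (λ a → ∑ B λ b → 𝟙 (P? a) * 𝟙 (_≟_ {B} b (f a)))
      ≡⟨ ∑-comm A B _ ⟩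
    ∑ B (λ b → ∑ A λ a → 𝟙 (P? a) * 𝟙 (_≟_ {B} b (f a)))
      ≡⟨ (∑-cong B λ b → ∑-cong A λ a → graph-symmetric a b) ⟩
    ∑ B (λ b → ∑ A λ a → 𝟙 (Q? b) * 𝟙 (_≟_ {A} a (g b)))
      ≡⟨ (∑-cong B λ b → ∑-𝟙-≡-* A (g b) (𝟙 (Q? b))) ⟩
    ∑ B (λ b → 𝟙 (Q? b)) ∎
    where
    open ≡-Reasoning
    to : ∀ a b → P a × b ≡ f a → Q b × a ≡ g b
    to a b (pa , refl) = f-Q a pa , sym (gf a pa)
    from : ∀ a b → Q b × a ≡ g b → P a × b ≡ f a
    from a b (qb , refl) = g-P b qb , sym (fg b qb)
    graph-symmetric : ∀ a b → 𝟙 (P? a) * 𝟙 (_≟_ {B} b (f a)) ≡ 𝟙 (Q? b) * 𝟙 (_≟_ {A} a (g b))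
    graph-symmetric a b = begin
      𝟙 (P? a) * 𝟙 (_≟_ {B} b (f a))      ≡⟨ 𝟙-× (P? a) _ ⟨
      𝟙 (P? a ×-dec _≟_ {B} b (f a))      ≡⟨ 𝟙-⇔ (to a b) (from a b) _ _ ⟩
      𝟙 (Q? b ×-dec _≟_ {A} a (g b))      ≡⟨ 𝟙-× (Q? b) _ ⟩
      𝟙 (Q? b) * 𝟙 (_≟_ {A} a (g b))      ∎

  count-⊂ : ∀ A {P Q : El A → Set} (P? : ∀ a → Dec (P a)) (Q? : ∀ a → Dec (Q a)) →
            (∀ a → P a → Q a) → ∀ m → Q m → ¬ P m → count A P? ℕ.< count A Q?
  count-⊂ A {P} {Q} P? Q? P⊆Q m Qm ¬Pm = begin
    suc (count A P?)                                 ≡⟨ ℕ.+-comm 1 (count A P?) ⟩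
    count A P? + 1                                   ≡⟨ cong (count A P? +_) (∑-𝟙-≡ A m) ⟨
    count A P? + ∑ A (λ a → 𝟙 (_≟_ {A} a m))         ≡⟨ ∑-+ A _ _ ⟨
    ∑ A (λ a → 𝟙 (P? a) + 𝟙 (_≟_ {A} a m))           ≤⟨ ∑-mono-≤ A (λ a → pointwise a (P? a) (_≟_ {A} a m)) ⟩
    count A Q?                                       ∎
    where
    open ℕ.≤-Reasoning
    pointwise : ∀ a (Pa? : Dec (P a)) (a≟m : Dec (a ≡ m)) → 𝟙 Pa? + 𝟙 a≟m ≤ 𝟙 (Q? a)
    pointwise a (yes Pa) (yes refl) = ⊥-elim (¬Pm Pa)
    pointwise a (yes Pa) (no _)     = ℕ.≤-reflexive (sym (𝟙-yes (P⊆Q a Pa) (Q? a)))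
    pointwise a (no _)   (yes refl) = ℕ.≤-reflexive (sym (𝟙-yes Qm (Q? a)))
    pointwise a (no _)   (no _)     = ℕ.z≤n

  ∑-*-∑ : ∀ A B (f : El A → ℕ) (g : El B → ℕ) → ∑ A (λ a → ∑ B λ b → f a * g b) ≡ ∑ A f * ∑ B g
  ∑-*-∑ A B f g = begin
    ∑ A (λ a → ∑ B λ b → f a * g b)   ≡⟨ ∑-cong A (λ a → ∑-*ˡ B (f a) g) ⟩
    ∑ A (λ a → f a * ∑ B g)           ≡⟨ ∑-cong A (λ a → ℕ.*-comm (f a) _) ⟩
    ∑ A (λ a → ∑ B g * f a)           ≡⟨ ∑-*ˡ A (∑ B g) f ⟩
    ∑ B g * ∑ A f                     ≡⟨ ℕ.*-comm (∑ B g) _ ⟩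
    ∑ A f * ∑ B g                     ∎
    where open ≡-Reasoning

  count-split : ∀ A {P R : El A → Set} (P? : ∀ a → Dec (P a)) (R? : ∀ a → Dec (R a)) →
                count A P? ≡ count A (λ a → P? a ×-dec R? a) + count A (λ a → P? a ×-dec ¬? (R? a))
  count-split A P? R? = trans (∑-cong A λ a → pointwise (P? a) (R? a)) (∑-+ A _ _)
    where
    pointwise : ∀ {P R : Set} (P? : Dec P) (R? : Dec R) → 𝟙 P? ≡ 𝟙 (P? ×-dec R?) + 𝟙 (P? ×-dec ¬? R?)
    pointwise (yes _) (yes _) = refl
    pointwise (yes _) (no _)  = refl
    pointwise (no _)  _       = refl

  count-complement : ∀ A {P : El A → Set} (P? : ∀ a → Dec (P a)) → count A P? + count A (λ a → ¬? (P? a)) ≡ ∑ A (λ _ → 1)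
  count-complement A P? = trans (sym (∑-+ A _ _)) (∑-cong A λ a → pointwise (P? a))
    where
    pointwise : ∀ {P : Set} (P? : Dec P) → 𝟙 P? + 𝟙 (¬? P?) ≡ 1
    pointwise (yes _) = refl
    pointwise (no _)  = refl

  count-× : ∀ A B {P : El A → Set} {Q : El B → Set} (P? : ∀ a → Dec (P a)) (Q? : ∀ b → Dec (Q b)) →
            count (A ⊗ B) (λ (a , b) → P? a ×-dec Q? b) ≡ count A P? * count B Q?
  count-× A B P? Q? = trans (∑-cong A λ a → ∑-cong B λ b → 𝟙-× (P? a) (Q? b)) (∑-*-∑ A B _ _)

  length-filter : ∀ {A : Set} {P : A → Set} (P? : ∀ a → Dec (P a)) xs →
                  length (filter P? xs) ≡ sumˡ (List.map (λ a → 𝟙 (P? a)) xs)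
  length-filter P? []       = refl
  length-filter P? (x ∷ xs) with P? x
  ... | yes _ = cong suc (length-filter P? xs)
  ... | no  _ = length-filter P? xs

  sum-cartesianProduct : ∀ {A B : Set} (f : A × B → ℕ) xs (ys : List B) →
    sumˡ (List.map f (cartesianProduct xs ys)) ≡ sumˡ (List.map (λ x → sumˡ (List.map (λ y → f (x , y)) ys)) xs)
  sum-cartesianProduct f []       ys = refl
  sum-cartesianProduct f (x ∷ xs) ys = begin
    sumˡ (List.map f (List.map (x ,_) ys List.++ cartesianProduct xs ys))
      ≡⟨ cong sumˡ (map-++ f (List.map (x ,_) ys) _) ⟩
    sumˡ (List.map f (List.map (x ,_) ys) List.++ List.map f (cartesianProduct xs ys))
      ≡⟨ sum-++ (List.map f (List.map (x ,_) ys)) _ ⟩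
    sumˡ (List.map f (List.map (x ,_) ys)) + sumˡ (List.map f (cartesianProduct xs ys))
      ≡⟨ cong₂ _+_ (cong sumˡ (sym (map-∘ ys))) (sum-cartesianProduct f xs ys) ⟩
    sumˡ (List.map (λ y → f (x , y)) ys) + sumˡ (List.map (λ x → sumˡ (List.map (λ y → f (x , y)) ys)) xs)
      ∎
    where open ≡-Reasoning

  sum-allFin : (f : Fin n → ℕ) → sumˡ (List.map f (allFin n)) ≡ ∑ 𝔽 f
  sum-allFin f = trans (cong sumˡ (map-tabulate (λ i → i) f)) (sum-tabulate f)
    where
    sum-tabulate : ∀ {m} (g : Fin m → ℕ) → sumˡ (List.tabulate g) ≡ sum g
    sum-tabulate {zero}  g = refl
    sum-tabulate {suc m} g = cong (g zero +_) (sum-tabulate (λ i → g (suc i)))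

  length-filter-allFin² : ∀ {P : Fin n × Fin n → Set} (P? : ∀ a → Dec (P a)) →
                  length (filter P? (cartesianProduct (allFin n) (allFin n))) ≡ count (𝔽 ⊗ 𝔽) P?
  length-filter-allFin² P? = begin
    length (filter P? (cartesianProduct (allFin n) (allFin n)))
      ≡⟨ length-filter P? (cartesianProduct (allFin n) (allFin n)) ⟩
    sumˡ (List.map (λ a → 𝟙 (P? a)) (cartesianProduct (allFin n) (allFin n)))
      ≡⟨ sum-cartesianProduct (λ a → 𝟙 (P? a)) (allFin n) (allFin n) ⟩
    sumˡ (List.map (λ x → sumˡ (List.map (λ y → 𝟙 (P? (x , y))) (allFin n))) (allFin n))
      ≡⟨ sum-allFin _ ⟩
    ∑ 𝔽 (λ x → sumˡ (List.map (λ y → 𝟙 (P? (x , y))) (allFin n)))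
      ≡⟨ ∑-cong 𝔽 (λ x → sum-allFin _) ⟩
    count (𝔽 ⊗ 𝔽) P? ∎
    where open ≡-Reasoning

module PrimeField (p : ℕ) .{{_ : NonZero p}} (p-prime : Prime p) (p≢2 : p ≢ 2) where
  open ZMod p public
  open Counting p public
  open import Defs using (inv; invSearch)
  open import Data.Nat as ℕ using (suc; _%_)
  import Data.Nat.Properties as ℕ
  open import Data.Nat.DivMod using (m<n⇒m%n≡m; m*n%n≡0)
  open import Data.Nat.Divisibility using (_∣_; ∣⇒≤; m%n≡0⇒n∣m)
  open import Data.Nat.Primality using (euclidsLemma; prime⇒nonTrivial)
  open import Data.Nat.Coprimality using (prime⇒coprime; coprime-Bézout)
  open import Data.Nat.GCD using (module Bézout)
  open import Data.Fin using (Fin; toℕ)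
  open import Data.Fin.Properties using (toℕ-injective; toℕ<n)
  open import Data.List using (List; _∷_; allFin)
  open import Data.List.Membership.Propositional using (_∈_)
  open import Data.List.Membership.Propositional.Properties using (∈-allFin)
  open import Data.List.Relation.Unary.Any using (here; there)
  open import Data.Sum using (_⊎_; inj₁; inj₂)
  open import Data.Product using (Σ-syntax; _,_; proj₁; proj₂)
  open import Data.Empty using (⊥-elim)
  open import Relation.Nullary using (yes; no)
  open import Relation.Binary.PropositionalEquality hiding ([_])
  open ≡-Reasoning

  []-small : ∀ {n} → n ℕ.< p → toℕ [ n ] ≡ n
  []-small {n} n<p = trans (toℕ-[] n) (m<n⇒m%n≡m n<p)

  toℕ-0# : toℕ 0# ≡ 0
  toℕ-0# = []-small (ℕ.>-nonZero⁻¹ p)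

  toℕ≡0⇒≡0# : ∀ {x} → toℕ x ≡ 0 → x ≡ 0#
  toℕ≡0⇒≡0# x≡0 = toℕ-injective (trans x≡0 (sym toℕ-0#))

  toℕ≢0⇒≢0# : ∀ {x} → toℕ x ≢ 0 → x ≢ 0#
  toℕ≢0⇒≢0# toℕx≢0 x≡0 = toℕx≢0 (trans (cong toℕ x≡0) toℕ-0#)

  []-≢0# : ∀ {n} → 0 ℕ.< n → n ℕ.< p → [ n ] ≢ 0#
  []-≢0# {n} 0<n n<p [n]≡0 = ℕ.<⇒≢ 0<n (sym (trans (sym ([]-small n<p)) (trans (cong toℕ [n]≡0) toℕ-0#)))

  1≢0 : 1# ≢ 0#
  1≢0 = []-≢0# ℕ.z<s (ℕ.nonTrivial⇒n>1 p {{prime⇒nonTrivial p-prime}})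

  2≢0 : [ 2 ] ≢ 0#
  2≢0 = []-≢0# ℕ.z<s (ℕ.≤∧≢⇒< (ℕ.nonTrivial⇒n>1 p {{prime⇒nonTrivial p-prime}}) (λ 2≡p → p≢2 (sym 2≡p)))

  []-*p : ∀ k → [ k ℕ.* p ] ≡ 0#
  []-*p k = []-cong (trans (m*n%n≡0 k p) (sym (m<n⇒m%n≡m (ℕ.>-nonZero⁻¹ p))))

  multiple<p⇒≡0 : ∀ {a} → a ℕ.< p → p ∣ a → a ≡ 0
  multiple<p⇒≡0 {0}     _   _   = refl
  multiple<p⇒≡0 {suc a} a<p p∣a = ⊥-elim (ℕ.<⇒≱ a<p (∣⇒≤ p∣a))

  *-≡0 : ∀ x y → x * y ≡ 0# → x ≡ 0# ⊎ y ≡ 0#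
  *-≡0 x y xy≡0 with euclidsLemma (toℕ x) (toℕ y) p-prime p∣xy
    where
    p∣xy : p ∣ toℕ x ℕ.* toℕ y
    p∣xy = m%n≡0⇒n∣m _ p (trans (sym (toℕ-[] _)) (trans (cong toℕ xy≡0) toℕ-0#))
  ... | inj₁ p∣x = inj₁ (toℕ≡0⇒≡0# (multiple<p⇒≡0 (toℕ<n x) p∣x))
  ... | inj₂ p∣y = inj₂ (toℕ≡0⇒≡0# (multiple<p⇒≡0 (toℕ<n y) p∣y))

  infix 9 _⁻¹
  _⁻¹ : F → F
  x ⁻¹ = [ inv p (toℕ x) ]

  private
    invSearch-finds : ∀ a (us : List F) u → u ∈ us → (a ℕ.* toℕ u) % p ≡ 1 → (a ℕ.* invSearch p a us) % p ≡ 1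
    invSearch-finds a (v ∷ vs) u u∈us au≡1 with (a ℕ.* toℕ v) % p ℕ.≟ 1
    ... | yes av≡1 = av≡1
    ... | no  av≢1 with u∈us
    ...   | here refl = ⊥-elim (av≢1 au≡1)
    ...   | there u∈vs = invSearch-finds a vs u u∈vs au≡1

    1%p≡1 : 1 % p ≡ 1
    1%p≡1 = m<n⇒m%n≡m (ℕ.nonTrivial⇒n>1 p {{prime⇒nonTrivial p-prime}})

    inverse-exists : ∀ x → x ≢ 0# → Σ[ u ∈ F ] x * u ≡ 1#
    inverse-exists x x≢0 with coprime-Bézout (prime⇒coprime p-prime {{ℕ.≢-nonZero x≢0ℕ}} (toℕ<n x))
      where
      x≢0ℕ : toℕ x ≢ 0
      x≢0ℕ x≡0 = x≢0 (toℕ≡0⇒≡0# x≡0)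
    ... | Bézout.+- k y 1+ya≡kp = - [ y ] , (begin
      x * - [ y ]               ≡⟨ solve 2 (λ x y → x :* (:- y) := κ 1 :- (κ 1 :+ y :* x)) refl x [ y ] ⟩
      1# - (1# + [ y ] * x)     ≡⟨ cong (λ u → 1# - (1# + [ y ] * u)) ([]-toℕ x) ⟨
      1# - (1# + [ y ] * [ a ]) ≡⟨ cong (λ u → 1# - (1# + u)) ([]-* y a) ⟩
      1# - (1# + [ y ℕ.* a ])   ≡⟨ cong (λ u → 1# - u) ([]-+ 1 (y ℕ.* a)) ⟩
      1# - [ 1 ℕ.+ y ℕ.* a ]    ≡⟨ cong (λ n → 1# - [ n ]) 1+ya≡kp ⟩
      1# - [ k ℕ.* p ]          ≡⟨ cong (λ u → 1# - u) ([]-*p k) ⟩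
      1# - 0#                   ≡⟨ solve 0 (κ 1 :- κ 0 := κ 1) refl ⟩
      1#                        ∎)
      where
      a : ℕ
      a = toℕ x
    ... | Bézout.-+ k y 1+kp≡ya = [ y ] , (begin
      x * [ y ]                 ≡⟨ cong (_* [ y ]) ([]-toℕ x) ⟨
      [ a ] * [ y ]             ≡⟨ []-* a y ⟩
      [ a ℕ.* y ]               ≡⟨ cong [_] (ℕ.*-comm a y) ⟩
      [ y ℕ.* a ]               ≡⟨ cong [_] 1+kp≡ya ⟨
      [ 1 ℕ.+ k ℕ.* p ]         ≡⟨ []-+ 1 (k ℕ.* p) ⟨
      1# + [ k ℕ.* p ]          ≡⟨ cong (1# +_) ([]-*p k) ⟩
      1# + 0#                   ≡⟨ solve 0 (κ 1 :+ κ 0 := κ 1) refl ⟩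
      1#                        ∎)
      where
      a : ℕ
      a = toℕ x

  *-inverseʳ : ∀ x → x ≢ 0# → x * x ⁻¹ ≡ 1#
  *-inverseʳ x x≢0 = begin
    x * x ⁻¹                      ≡⟨ cong (_* x ⁻¹) ([]-toℕ x) ⟨
    [ toℕ x ] * [ inv p (toℕ x) ] ≡⟨ []-* (toℕ x) _ ⟩
    [ toℕ x ℕ.* inv p (toℕ x) ]   ≡⟨ []-cong (trans found (sym 1%p≡1)) ⟩
    1#                            ∎
    where
    u : F
    u = proj₁ (inverse-exists x x≢0)
    xu≡1 : (toℕ x ℕ.* toℕ u) % p ≡ 1
    xu≡1 = trans ([]-injective (proj₂ (inverse-exists x x≢0))) 1%p≡1
    found : (toℕ x ℕ.* inv p (toℕ x)) % p ≡ 1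
    found = invSearch-finds (toℕ x) (allFin p) u (∈-allFin u) xu≡1

  *-≢0 : ∀ {x y} → x ≢ 0# → y ≢ 0# → x * y ≢ 0#
  *-≢0 x≢0 y≢0 xy≡0 with *-≡0 _ _ xy≡0
  ... | inj₁ x≡0 = x≢0 x≡0
  ... | inj₂ y≡0 = y≢0 y≡0

  *-zeroʳ : ∀ x → x * 0# ≡ 0#
  *-zeroʳ = solve 1 (λ x → x :* κ 0 := κ 0) refl

  *-≡1⇒≢0 : ∀ {x y} → x * y ≡ 1# → x ≢ 0#
  *-≡1⇒≢0 {x} {y} xy≡1 x≡0 = 1≢0 (begin
    1#       ≡⟨ xy≡1 ⟨
    x * y    ≡⟨ cong (_* y) x≡0 ⟩
    0# * y   ≡⟨ solve 1 (λ y → κ 0 :* y := κ 0) refl y ⟩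
    0#       ∎)

  ⁻¹-≢0 : ∀ {x} → x ≢ 0# → x ⁻¹ ≢ 0#
  ⁻¹-≢0 {x} x≢0 = *-≡1⇒≢0 (trans (*-comm (x ⁻¹) x) (*-inverseʳ x x≢0))

  ⁻¹-unique : ∀ {x y} → x * y ≡ 1# → x ⁻¹ ≡ y
  ⁻¹-unique {x} {y} xy≡1 = begin
    x ⁻¹                 ≡⟨ *-identityʳ (x ⁻¹) ⟨
    x ⁻¹ * 1#            ≡⟨ cong (x ⁻¹ *_) xy≡1 ⟨
    x ⁻¹ * (x * y)       ≡⟨ solve 3 (λ u x y → u :* (x :* y) := (x :* u) :* y) refl (x ⁻¹) x y ⟩
    (x * x ⁻¹) * y       ≡⟨ cong (_* y) (*-inverseʳ x (*-≡1⇒≢0 xy≡1)) ⟩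
    1# * y               ≡⟨ *-identityˡ y ⟩
    y                    ∎

  x*y*y⁻¹≡x : ∀ x {y} → y ≢ 0# → x * y * y ⁻¹ ≡ x
  x*y*y⁻¹≡x x {y} y≢0 = begin
    x * y * y ⁻¹     ≡⟨ *-assoc x y (y ⁻¹) ⟩
    x * (y * y ⁻¹)   ≡⟨ cong (x *_) (*-inverseʳ y y≢0) ⟩
    x * 1#           ≡⟨ *-identityʳ x ⟩
    x                ∎

  x*y⁻¹*y≡x : ∀ x {y} → y ≢ 0# → x * y ⁻¹ * y ≡ x
  x*y⁻¹*y≡x x {y} y≢0 = trans (solve 3 (λ x y u → x :* u :* y := x :* y :* u) refl x y (y ⁻¹)) (x*y*y⁻¹≡x x y≢0)

  ⁻¹-* : ∀ {x y} → x ≢ 0# → y ≢ 0# → (x * y) ⁻¹ ≡ x ⁻¹ * y ⁻¹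
  ⁻¹-* {x} {y} x≢0 y≢0 = ⁻¹-unique (begin
    x * y * (x ⁻¹ * y ⁻¹)         ≡⟨ solve 4 (λ x y u v → x :* y :* (u :* v) := (x :* u) :* (y :* v)) refl x y (x ⁻¹) (y ⁻¹) ⟩
    (x * x ⁻¹) * (y * y ⁻¹)       ≡⟨ cong₂ _*_ (*-inverseʳ x x≢0) (*-inverseʳ y y≢0) ⟩
    1# * 1#                       ≡⟨ *-identityˡ 1# ⟩
    1#                            ∎)

  -1≢0 : - 1# ≢ 0#
  -1≢0 -1≡0 = 1≢0 (trans (sym (-‿involutive 1#)) (trans (cong -_ -1≡0) -0#≈0#))

  4≢0 : [ 4 ] ≢ 0#
  4≢0 = subst (_≢ 0#) ([]-* 2 2) (*-≢0 2≢0 2≢0)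

  16≢0 : [ 16 ] ≢ 0#
  16≢0 = subst (_≢ 0#) ([]-* 4 4) (*-≢0 4≢0 4≢0)

  ½ : F
  ½ = [ 2 ] ⁻¹

  2*½≡1 : [ 2 ] * ½ ≡ 1#
  2*½≡1 = *-inverseʳ [ 2 ] 2≢0

  2*x*½≡x : ∀ x → [ 2 ] * x * ½ ≡ x
  2*x*½≡x x = begin
    [ 2 ] * x * ½    ≡⟨ solve 3 (λ x t u → t :* x :* u := x :* (t :* u)) refl x [ 2 ] ½ ⟩
    x * ([ 2 ] * ½)  ≡⟨ cong (x *_) 2*½≡1 ⟩
    x * 1#           ≡⟨ *-identityʳ x ⟩
    x                ∎

module Squares (p : ℕ) .{{_ : NonZero p}} (p-prime : Prime p) (p≢2 : p ≢ 2) where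
  open PrimeField p p-prime p≢2 public
  open import Data.Nat as ℕ using (suc)
  import Data.Nat.Properties as ℕ
  import Data.Fin as Fin
  open import Data.Fin.Properties using (any?)
  open import Data.Sum as Sum using (_⊎_)
  open import Data.Product using (_×_; Σ-syntax; _,_; proj₂)
  open import Data.Empty using (⊥-elim)
  open import Relation.Nullary using (Dec; yes; no; ¬_)
  open import Relation.Nullary.Decidable using (_×-dec_; ¬?; decidable-stable)
  open import Relation.Binary.PropositionalEquality hiding ([_])
  open ≡-Reasoning

  infix 4 _≟F_
  _≟F_ : (x y : F) → Dec (x ≡ y)
  _≟F_ = Fin._≟_

  x-y≡0⇒x≡y : ∀ {x y} → x - y ≡ 0# → x ≡ y
  x-y≡0⇒x≡y {x} {y} x-y≡0 = begin
    x              ≡⟨ solve 2 (λ x y → x := (x :- y) :+ y) refl x y ⟩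
    (x - y) + y    ≡⟨ cong (_+ y) x-y≡0 ⟩
    0# + y         ≡⟨ +-identityˡ y ⟩
    y              ∎

  x+y≡0⇒x≡-y : ∀ {x y} → x + y ≡ 0# → x ≡ - y
  x+y≡0⇒x≡-y {x} {y} x+y≡0 = x-y≡0⇒x≡y (trans (solve 2 (λ x y → x :- (:- y) := x :+ y) refl x y) x+y≡0)

  roots : F → ℕ
  roots a = count 𝔽 (λ z → z * z ≟F a)

  IsSquare : F → Set
  IsSquare a = Σ[ s ∈ F ] s * s ≡ a

  isSquare? : ∀ a → Dec (IsSquare a)
  isSquare? a = any? (λ s → s * s ≟F a)

  difference-of-squares : ∀ z s → (z - s) * (z + s) ≡ z * z - s * s
  difference-of-squares = solve 2 (λ z s → (z :- s) :* (z :+ s) := z :* z :- s :* s) refl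

  square-roots : ∀ {z s} → z * z ≡ s * s → z ≡ s ⊎ z ≡ - s
  square-roots {z} {s} z²≡s² = Sum.map x-y≡0⇒x≡y x+y≡0⇒x≡-y
    (*-≡0 (z - s) (z + s) (trans (difference-of-squares z s) (trans (cong (_- s * s) z²≡s²) (-‿inverseʳ (s * s)))))

  x≢-x : ∀ {x} → x ≢ 0# → x ≢ - x
  x≢-x {x} x≢0 x≡-x = *-≢0 2≢0 x≢0 (begin
    [ 2 ] * x     ≡⟨ solve 1 (λ x → κ 2 :* x := x :+ x) refl x ⟩
    x + x         ≡⟨ cong (x +_) x≡-x ⟩
    x + - x       ≡⟨ -‿inverseʳ x ⟩
    0#            ∎)

  roots-0 : roots 0# ≡ 1
  roots-0 = trans (count-⇔ 𝔽 _ (_≟F 0#) z²≡0⇒z≡0 (λ { _ refl → *-zeroʳ 0# })) (∑-𝟙-≡ 𝔽 0#)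
    where
    z²≡0⇒z≡0 : ∀ z → z * z ≡ 0# → z ≡ 0#
    z²≡0⇒z≡0 z z²≡0 = Sum.reduce (*-≡0 z z z²≡0)

  roots-square : ∀ {s} → s ≢ 0# → roots (s * s) ≡ 2
  roots-square {s} s≢0 = begin
    ∑ 𝔽 (λ z → 𝟙 (z * z ≟F s * s))                     ≡⟨ ∑-cong 𝔽 (λ z → pointwise z (z ≟F s) (z ≟F - s)) ⟩
    ∑ 𝔽 (λ z → 𝟙 (z ≟F s) ℕ.+ 𝟙 (z ≟F - s))            ≡⟨ ∑-+ 𝔽 _ _ ⟩
    ∑ 𝔽 (λ z → 𝟙 (z ≟F s)) ℕ.+ ∑ 𝔽 (λ z → 𝟙 (z ≟F - s)) ≡⟨ cong₂ ℕ._+_ (∑-𝟙-≡ 𝔽 s) (∑-𝟙-≡ 𝔽 (- s)) ⟩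
    2                                                  ∎
    where
    -s*-s≡s*s : - s * - s ≡ s * s
    -s*-s≡s*s = solve 1 (λ s → (:- s) :* (:- s) := s :* s) refl s
    pointwise : ∀ z (z≟s : Dec (z ≡ s)) (z≟-s : Dec (z ≡ - s)) → 𝟙 (z * z ≟F s * s) ≡ 𝟙 z≟s ℕ.+ 𝟙 z≟-s
    pointwise z (yes z≡s) (yes z≡-s) = ⊥-elim (x≢-x s≢0 (trans (sym z≡s) z≡-s))
    pointwise z (yes refl) (no _)    = 𝟙-yes refl (z * z ≟F s * s)
    pointwise z (no _) (yes refl)    = 𝟙-yes -s*-s≡s*s (z * z ≟F s * s)
    pointwise z (no z≢s) (no z≢-s)   = 𝟙-no (λ z²≡s² → Sum.[ z≢s , z≢-s ]′ (square-roots z²≡s²)) (z * z ≟F s * s)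

  roots-nonsquare : ∀ {a} → ¬ IsSquare a → roots a ≡ 0
  roots-nonsquare {a} ¬□a = trans (∑-cong 𝔽 λ z → 𝟙-no (λ z²≡a → ¬□a (z , z²≡a)) (z * z ≟F a)) (∑-zero 𝔽)

  ∑-roots : ∀ (σ τ : F → F) → (∀ v → τ (σ v) ≡ v) → (∀ a → σ (τ a) ≡ a) → ∑ 𝔽 (λ v → roots (σ v)) ≡ p
  ∑-roots σ τ τσ στ = begin
    ∑ 𝔽 (λ v → ∑ 𝔽 λ z → 𝟙 (z * z ≟F σ v))   ≡⟨ ∑-comm 𝔽 𝔽 _ ⟩
    ∑ 𝔽 (λ z → ∑ 𝔽 λ v → 𝟙 (z * z ≟F σ v))   ≡⟨ (∑-cong 𝔽 λ z → ∑-cong 𝔽 λ v → 𝟙-⇔ (to z v) (from z v) _ (v ≟F τ (z * z))) ⟩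
    ∑ 𝔽 (λ z → ∑ 𝔽 λ v → 𝟙 (v ≟F τ (z * z))) ≡⟨ ∑-cong 𝔽 (λ z → ∑-𝟙-≡ 𝔽 (τ (z * z))) ⟩
    ∑ 𝔽 (λ _ → 1)                            ≡⟨ ∑-𝔽-1 ⟩
    p                                        ∎
    where
    to : ∀ z v → z * z ≡ σ v → v ≡ τ (z * z)
    to z v z²≡σv = trans (sym (τσ v)) (cong τ (sym z²≡σv))
    from : ∀ z v → v ≡ τ (z * z) → z * z ≡ σ v
    from z v refl = sym (στ (z * z))

  NonzeroSquare NonzeroNonsquare : F → Set
  NonzeroSquare    a = a ≢ 0# × IsSquare a
  NonzeroNonsquare a = a ≢ 0# × ¬ IsSquare a

  nonzeroSquare? : ∀ a → Dec (NonzeroSquare a)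
  nonzeroSquare? a = ¬? (a ≟F 0#) ×-dec isSquare? a

  nonzeroNonsquare? : ∀ a → Dec (NonzeroNonsquare a)
  nonzeroNonsquare? a = ¬? (a ≟F 0#) ×-dec ¬? (isSquare? a)

  #squares #nonsquares : ℕ
  #squares    = count 𝔽 nonzeroSquare?
  #nonsquares = count 𝔽 nonzeroNonsquare?

  square≢0⇒root≢0 : ∀ {s} → s * s ≢ 0# → s ≢ 0#
  square≢0⇒root≢0 {s} s²≢0 s≡0 = s²≢0 (trans (cong (λ u → u * u) s≡0) (*-zeroʳ 0#))

  data Class : F → Set where
    zero      : Class 0#
    square    : ∀ {a} → NonzeroSquare a → Class a
    nonsquare : ∀ {a} → NonzeroNonsquare a → Class a

  classify : ∀ a → Class a
  classify a with a ≟F 0# | isSquare? a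
  ... | yes refl | _     = zero
  ... | no a≢0  | yes □a = square (a≢0 , □a)
  ... | no a≢0  | no ¬□a = nonsquare (a≢0 , ¬□a)

  roots-nonzeroSquare : ∀ {a} → NonzeroSquare a → roots a ≡ 2
  roots-nonzeroSquare (s²≢0 , s , refl) = roots-square {s} (square≢0⇒root≢0 s²≢0)

  roots-by-class : ∀ a → roots a ≡ 𝟙 (a ≟F 0#) ℕ.+ 2 ℕ.* 𝟙 (nonzeroSquare? a)
  roots-by-class a with classify a
  ... | zero = trans roots-0 (sym (cong₂ (λ i j → i ℕ.+ 2 ℕ.* j)
    (𝟙-yes refl (0# ≟F 0#)) (𝟙-no (λ (0≢0 , _) → 0≢0 refl) (nonzeroSquare? 0#))))
  ... | square □a@(a≢0 , _) = trans (roots-nonzeroSquare □a) (sym (cong₂ (λ i j → i ℕ.+ 2 ℕ.* j)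
    (𝟙-no a≢0 (a ≟F 0#)) (𝟙-yes □a (nonzeroSquare? a))))
  ... | nonsquare (a≢0 , ¬□a) = trans (roots-nonsquare ¬□a) (sym (cong₂ (λ i j → i ℕ.+ 2 ℕ.* j)
    (𝟙-no a≢0 (a ≟F 0#)) (𝟙-no (λ (_ , □a) → ¬□a □a) (nonzeroSquare? a))))

  private
    +-cong₃ : ∀ {i j k i′ j′ k′} → i ≡ i′ → j ≡ j′ → k ≡ k′ → i ℕ.+ j ℕ.+ k ≡ i′ ℕ.+ j′ ℕ.+ k′
    +-cong₃ refl refl refl = refl

  partition : ∀ a → 𝟙 (a ≟F 0#) ℕ.+ 𝟙 (nonzeroSquare? a) ℕ.+ 𝟙 (nonzeroNonsquare? a) ≡ 1
  partition a with classify a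
  ... | zero = +-cong₃ (𝟙-yes refl (0# ≟F 0#))
    (𝟙-no (λ (0≢0 , _) → 0≢0 refl) (nonzeroSquare? 0#)) (𝟙-no (λ (0≢0 , _) → 0≢0 refl) (nonzeroNonsquare? 0#))
  ... | square □a@(a≢0 , □) = +-cong₃ (𝟙-no a≢0 (a ≟F 0#))
    (𝟙-yes □a (nonzeroSquare? a)) (𝟙-no (λ (_ , ¬□a) → ¬□a □) (nonzeroNonsquare? a))
  ... | nonsquare ¬□a@(a≢0 , ¬□) = +-cong₃ (𝟙-no a≢0 (a ≟F 0#))
    (𝟙-no (λ (_ , □) → ¬□ □) (nonzeroSquare? a)) (𝟙-yes ¬□a (nonzeroNonsquare? a))

  p≡1+2*#squares : p ≡ 1 ℕ.+ 2 ℕ.* #squares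
  p≡1+2*#squares = begin
    p                                                   ≡⟨ ∑-roots (λ a → a) (λ a → a) (λ _ → refl) (λ _ → refl) ⟨
    ∑ 𝔽 roots                                           ≡⟨ ∑-cong 𝔽 roots-by-class ⟩
    ∑ 𝔽 (λ a → 𝟙 (a ≟F 0#) ℕ.+ 2 ℕ.* 𝟙 (nonzeroSquare? a)) ≡⟨ ∑-+ 𝔽 _ _ ⟩
    ∑ 𝔽 (λ a → 𝟙 (a ≟F 0#)) ℕ.+ ∑ 𝔽 (λ a → 2 ℕ.* 𝟙 (nonzeroSquare? a)) ≡⟨ cong₂ ℕ._+_ (∑-𝟙-≡ 𝔽 0#) (∑-*ˡ 𝔽 2 _) ⟩
    1 ℕ.+ 2 ℕ.* #squares                                ∎

  1+#squares+#nonsquares≡p : 1 ℕ.+ #squares ℕ.+ #nonsquares ≡ p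
  1+#squares+#nonsquares≡p = begin
    1 ℕ.+ #squares ℕ.+ #nonsquares            ≡⟨ cong (λ u → u ℕ.+ #squares ℕ.+ #nonsquares) (∑-𝟙-≡ 𝔽 0#) ⟨
    ∑ 𝔽 (λ a → 𝟙 (a ≟F 0#)) ℕ.+ #squares ℕ.+ #nonsquares ≡⟨ cong (ℕ._+ #nonsquares) (∑-+ 𝔽 _ _) ⟨
    ∑ 𝔽 (λ a → 𝟙 (a ≟F 0#) ℕ.+ 𝟙 (nonzeroSquare? a)) ℕ.+ #nonsquares ≡⟨ ∑-+ 𝔽 _ _ ⟨
    ∑ 𝔽 (λ a → 𝟙 (a ≟F 0#) ℕ.+ 𝟙 (nonzeroSquare? a) ℕ.+ 𝟙 (nonzeroNonsquare? a)) ≡⟨ ∑-cong 𝔽 partition ⟩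
    ∑ 𝔽 (λ _ → 1)                             ≡⟨ ∑-𝔽-1 ⟩
    p                                         ∎

  #nonsquares≡#squares : #nonsquares ≡ #squares
  #nonsquares≡#squares = ℕ.+-cancelˡ-≡ (1 ℕ.+ #squares) _ _ (begin
    1 ℕ.+ #squares ℕ.+ #nonsquares     ≡⟨ 1+#squares+#nonsquares≡p ⟩
    p                                  ≡⟨ p≡1+2*#squares ⟩
    1 ℕ.+ 2 ℕ.* #squares               ≡⟨ cong suc (cong (#squares ℕ.+_) (ℕ.+-identityʳ #squares)) ⟩
    1 ℕ.+ #squares ℕ.+ #squares        ∎)

  square*square : ∀ {a b} → IsSquare a → IsSquare b → IsSquare (a * b)
  square*square (s , refl) (t , refl) = s * t , solve 2 (λ s t → (s :* t) :* (s :* t) := (s :* s) :* (t :* t)) refl s t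

  square*nonsquare : ∀ {a b} → NonzeroSquare a → ¬ IsSquare b → ¬ IsSquare (a * b)
  square*nonsquare {_} {b} (s²≢0 , s , refl) ¬□b (r , r²≡s²b) = ¬□b (r * s ⁻¹ , (begin
    (r * s ⁻¹) * (r * s ⁻¹)   ≡⟨ solve 2 (λ r u → (r :* u) :* (r :* u) := (r :* r) :* u :* u) refl r (s ⁻¹) ⟩
    r * r * s ⁻¹ * s ⁻¹       ≡⟨ cong (λ u → u * s ⁻¹ * s ⁻¹) r²≡s²b ⟩
    s * s * b * s ⁻¹ * s ⁻¹   ≡⟨ solve 3 (λ s b u → s :* s :* b :* u :* u := b :* s :* u :* s :* u) refl s b (s ⁻¹) ⟩
    b * s * s ⁻¹ * s * s ⁻¹   ≡⟨ cong (λ u → u * s * s ⁻¹) (x*y*y⁻¹≡x b s≢0) ⟩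
    b * s * s ⁻¹              ≡⟨ x*y*y⁻¹≡x b s≢0 ⟩
    b                         ∎))
    where
    s≢0 : s ≢ 0#
    s≢0 = square≢0⇒root≢0 s²≢0

  -- Multiplication by a nonsquare n sends the #squares nonzero squares into the #nonsquares = #squares
  -- nonzero nonsquares; were n * m a nonsquare, m would be a further nonsquare outside the image.
  nonsquare*nonsquare : ∀ {n m} → NonzeroNonsquare n → NonzeroNonsquare m → IsSquare (n * m)
  nonsquare*nonsquare {n} {m} (n≢0 , ¬□n) (m≢0 , ¬□m) = decidable-stable (isSquare? (n * m)) λ ¬□nm →
    ℕ.<-irrefl refl (subst₂ ℕ._<_ #multiples≡#squares #nonsquares≡#squares
      (count-⊂ 𝔽 multipleOfN? nonzeroNonsquare? multiple⇒nonsquare m (m≢0 , ¬□m) (m-not-multiple ¬□nm)))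
    where
    MultipleOfN : F → Set
    MultipleOfN x = x ≢ 0# × IsSquare (x * n ⁻¹)
    multipleOfN? : ∀ x → Dec (MultipleOfN x)
    multipleOfN? x = ¬? (x ≟F 0#) ×-dec isSquare? (x * n ⁻¹)
    #multiples≡#squares : count 𝔽 multipleOfN? ≡ #squares
    #multiples≡#squares = count-bijection 𝔽 𝔽 multipleOfN? nonzeroSquare? (_* n ⁻¹) (_* n)
      (λ x (x≢0 , □) → *-≢0 x≢0 (⁻¹-≢0 n≢0) , □)
      (λ y (y≢0 , □y) → *-≢0 y≢0 n≢0 , subst IsSquare (sym (x*y*y⁻¹≡x y n≢0)) □y)
      (λ x _ → x*y⁻¹*y≡x x n≢0)
      (λ y _ → x*y*y⁻¹≡x y n≢0)
    multiple⇒nonsquare : ∀ x → MultipleOfN x → NonzeroNonsquare x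
    multiple⇒nonsquare x (x≢0 , □) = x≢0 , λ □x → square*nonsquare (*-≢0 x≢0 (⁻¹-≢0 n≢0) , □) ¬□n
      (subst IsSquare (sym (x*y⁻¹*y≡x x n≢0)) □x)
    m-not-multiple : ¬ IsSquare (n * m) → ¬ MultipleOfN m
    m-not-multiple ¬□nm (_ , s , s²≡m/n) = ¬□nm (n * s , (begin
      (n * s) * (n * s)     ≡⟨ solve 2 (λ n s → (n :* s) :* (n :* s) := n :* n :* (s :* s)) refl n s ⟩
      n * n * (s * s)       ≡⟨ cong (n * n *_) s²≡m/n ⟩
      n * n * (m * n ⁻¹)    ≡⟨ solve 3 (λ n m u → n :* n :* (m :* u) := n :* m :* n :* u) refl n m (n ⁻¹) ⟩
      n * m * n * n ⁻¹      ≡⟨ x*y*y⁻¹≡x (n * m) n≢0 ⟩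
      n * m                 ∎))

  private
    by-values : ∀ {a b i j k} → roots a ≡ i → roots b ≡ j → roots (a * b) ≡ k → i ℕ.* j ℕ.+ 2 ≡ i ℕ.+ j ℕ.+ k →
             roots a ℕ.* roots b ℕ.+ 2 ≡ roots a ℕ.+ roots b ℕ.+ roots (a * b)
    by-values refl refl refl e = e

    roots-0*x : ∀ x → roots (0# * x) ≡ 1
    roots-0*x x = trans (cong roots (solve 1 (λ x → κ 0 :* x := κ 0) refl x)) roots-0

    roots-x*0 : ∀ x → roots (x * 0#) ≡ 1
    roots-x*0 x = trans (cong roots (*-zeroʳ x)) roots-0

  -- With χ a = roots a − 1 (the Legendre symbol) this is χ (a * b) ≡ χ a * χ b.
  roots-* : ∀ a b → roots a ℕ.* roots b ℕ.+ 2 ≡ roots a ℕ.+ roots b ℕ.+ roots (a * b)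
  roots-* a b with classify a | classify b
  ... | zero | zero         = by-values roots-0 roots-0 (roots-0*x 0#) refl
  ... | zero | square □b    = by-values roots-0 (roots-nonzeroSquare □b) (roots-0*x b) refl
  ... | zero | nonsquare ¬□b = by-values roots-0 (roots-nonsquare (proj₂ ¬□b)) (roots-0*x b) refl
  ... | square □a | zero     = by-values (roots-nonzeroSquare □a) roots-0 (roots-x*0 a) refl
  ... | nonsquare ¬□a | zero = by-values (roots-nonsquare (proj₂ ¬□a)) roots-0 (roots-x*0 a) refl
  ... | square □a@(a≢0 , □) | square □b@(b≢0 , □′) =
    by-values (roots-nonzeroSquare □a) (roots-nonzeroSquare □b) (roots-nonzeroSquare (*-≢0 a≢0 b≢0 , square*square □ □′)) refl
  ... | square □a | nonsquare (_ , ¬□b) =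
    by-values (roots-nonzeroSquare □a) (roots-nonsquare ¬□b) (roots-nonsquare (square*nonsquare □a ¬□b)) refl
  ... | nonsquare (_ , ¬□a) | square □b =
    by-values (roots-nonsquare ¬□a) (roots-nonzeroSquare □b) (roots-nonsquare (λ □ab → square*nonsquare □b ¬□a (subst IsSquare (*-comm a b) □ab))) refl
  ... | nonsquare ¬□a@(a≢0 , _) | nonsquare ¬□b@(b≢0 , _) =
    by-values (roots-nonsquare (proj₂ ¬□a)) (roots-nonsquare (proj₂ ¬□b)) (roots-nonzeroSquare (*-≢0 a≢0 b≢0 , nonsquare*nonsquare ¬□a ¬□b)) refl

module Conic (p : ℕ) .{{_ : NonZero p}} (p-prime : Prime p) (p≢2 : p ≢ 2) where
  open Squares p p-prime p≢2 public
  import Data.Nat as ℕ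
  import Data.Nat.Properties as ℕ
  open import Data.Product using (_×_; _,_)
  open import Relation.Nullary using (Dec)
  open import Relation.Nullary.Decidable using (¬?)
  open import Relation.Binary.PropositionalEquality hiding ([_])
  open ≡-Reasoning

  -- h q = (q + 1)² / q
  h : F → F
  h q = q + [ 2 ] + q ⁻¹

  Conic : F × F → Set
  Conic (v , w) = w * w ≡ v * v - [ 4 ] * v

  conic? : ∀ vw → Dec (Conic vw)
  conic? (v , w) = w * w ≟F v * v - [ 4 ] * v

  conic-point : F → F × F
  conic-point q = h q , q - q ⁻¹

  conic-parameter : F × F → F
  conic-parameter (v , w) = (v - [ 2 ] + w) * ½

  conic-point∈Conic : ∀ {q} → q ≢ 0# → Conic (conic-point q)
  conic-point∈Conic {q} q≢0 = sym (begin
    h q * h q - [ 4 ] * h q                      ≡⟨ solve 2 (λ q r → (q :+ κ 2 :+ r) :* (q :+ κ 2 :+ r) :- κ 4 :* (q :+ κ 2 :+ r)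
                                                             := (q :- r) :* (q :- r) :+ κ 4 :* (q :* r) :- κ 4) refl q (q ⁻¹) ⟩
    (q - q ⁻¹) * (q - q ⁻¹) + [ 4 ] * (q * q ⁻¹) - [ 4 ] ≡⟨ cong (λ u → (q - q ⁻¹) * (q - q ⁻¹) + [ 4 ] * u - [ 4 ]) (*-inverseʳ q q≢0) ⟩
    (q - q ⁻¹) * (q - q ⁻¹) + [ 4 ] * 1# - [ 4 ]          ≡⟨ solve 1 (λ w → w :+ κ 4 :* κ 1 :- κ 4 := w) refl _ ⟩
    (q - q ⁻¹) * (q - q ⁻¹)                              ∎)

  conic-parameter-inverse : ∀ {v w} → Conic (v , w) → conic-parameter (v , w) * ((v - [ 2 ] - w) * ½) ≡ 1#
  conic-parameter-inverse {v} {w} w²≡ = begin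
    (v - [ 2 ] + w) * ½ * ((v - [ 2 ] - w) * ½)          ≡⟨ solve 3 (λ v w u → (v :- κ 2 :+ w) :* u :* ((v :- κ 2 :- w) :* u)
                                                                := (v :* v :- κ 4 :* v :- w :* w :+ κ 4) :* u :* u) refl v w ½ ⟩
    (v * v - [ 4 ] * v - w * w + [ 4 ]) * ½ * ½          ≡⟨ cong (λ u → (v * v - [ 4 ] * v - u + [ 4 ]) * ½ * ½) w²≡ ⟩
    (v * v - [ 4 ] * v - (v * v - [ 4 ] * v) + [ 4 ]) * ½ * ½ ≡⟨ solve 2 (λ a u → (a :- a :+ κ 4) :* u :* u := κ 2 :* (κ 2 :* κ 1 :* u) :* u) refl (v * v - [ 4 ] * v) ½ ⟩
    [ 2 ] * ([ 2 ] * 1# * ½) * ½                          ≡⟨ cong (λ u → [ 2 ] * u * ½) (2*x*½≡x 1#) ⟩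
    [ 2 ] * 1# * ½                                        ≡⟨ 2*x*½≡x 1# ⟩
    1#                                                    ∎

  conic-parameter≢0 : ∀ {vw} → Conic vw → conic-parameter vw ≢ 0#
  conic-parameter≢0 w²≡ = *-≡1⇒≢0 (conic-parameter-inverse w²≡)

  conic-point-parameter : ∀ {vw} → Conic vw → conic-point (conic-parameter vw) ≡ vw
  conic-point-parameter {v , w} w²≡ = cong₂ _,_ (begin
    q + [ 2 ] + q ⁻¹                  ≡⟨ cong (λ u → q + [ 2 ] + u) q⁻¹≡r ⟩
    q + [ 2 ] + r                     ≡⟨ solve 3 (λ v w u → (v :- κ 2 :+ w) :* u :+ κ 2 :+ (v :- κ 2 :- w) :* u
                                                   := κ 2 :* (v :- κ 2) :* u :+ κ 2) refl v w ½ ⟩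
    [ 2 ] * (v - [ 2 ]) * ½ + [ 2 ]   ≡⟨ cong (_+ [ 2 ]) (2*x*½≡x (v - [ 2 ])) ⟩
    v - [ 2 ] + [ 2 ]                 ≡⟨ solve 1 (λ v → v :- κ 2 :+ κ 2 := v) refl v ⟩
    v                                 ∎) (begin
    q - q ⁻¹                          ≡⟨ cong (λ u → q - u) q⁻¹≡r ⟩
    q - r                             ≡⟨ solve 3 (λ v w u → (v :- κ 2 :+ w) :* u :- (v :- κ 2 :- w) :* u := κ 2 :* w :* u) refl v w ½ ⟩
    [ 2 ] * w * ½                     ≡⟨ 2*x*½≡x w ⟩
    w                                 ∎)
    where
    q r : F
    q = conic-parameter (v , w)
    r = (v - [ 2 ] - w) * ½
    q⁻¹≡r : q ⁻¹ ≡ r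
    q⁻¹≡r = ⁻¹-unique (conic-parameter-inverse w²≡)

  conic-parameter-point : ∀ q → conic-parameter (conic-point q) ≡ q
  conic-parameter-point q = begin
    (q + [ 2 ] + q ⁻¹ - [ 2 ] + (q - q ⁻¹)) * ½   ≡⟨ solve 3 (λ q r u → (q :+ κ 2 :+ r :- κ 2 :+ (q :- r)) :* u := κ 2 :* q :* u) refl q (q ⁻¹) ½ ⟩
    [ 2 ] * q * ½                                ≡⟨ 2*x*½≡x q ⟩
    q                                            ∎

  #Conic+1≡p : count (𝔽 ⊗ 𝔽) conic? ℕ.+ 1 ≡ p
  #Conic+1≡p = begin
    count (𝔽 ⊗ 𝔽) conic? ℕ.+ 1                     ≡⟨ cong (ℕ._+ 1) #Conic≡#nonzero ⟩
    count 𝔽 (λ q → ¬? (q ≟F 0#)) ℕ.+ 1             ≡⟨ ℕ.+-comm _ 1 ⟩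
    1 ℕ.+ count 𝔽 (λ q → ¬? (q ≟F 0#))             ≡⟨ cong (ℕ._+ count 𝔽 (λ q → ¬? (q ≟F 0#))) (∑-𝟙-≡ 𝔽 0#) ⟨
    count 𝔽 (_≟F 0#) ℕ.+ count 𝔽 (λ q → ¬? (q ≟F 0#)) ≡⟨ count-complement 𝔽 (_≟F 0#) ⟩
    ∑ 𝔽 (λ _ → 1)                                  ≡⟨ ∑-𝔽-1 ⟩
    p                                              ∎
    where
    #Conic≡#nonzero : count (𝔽 ⊗ 𝔽) conic? ≡ count 𝔽 (λ q → ¬? (q ≟F 0#))
    #Conic≡#nonzero = count-bijection (𝔽 ⊗ 𝔽) 𝔽 conic? (λ q → ¬? (q ≟F 0#)) conic-parameter conic-point
      (λ _ → conic-parameter≢0) (λ _ → conic-point∈Conic)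
      (λ _ → conic-point-parameter) (λ q _ → conic-parameter-point q)

module EllipticCurve (p : ℕ) .{{_ : NonZero p}} (p-prime : Prime p) (p≢2 : p ≢ 2) where
  open Conic p p-prime p≢2 public
  import Data.Nat as ℕ
  import Data.Nat.Properties as ℕ
  open import Data.Product using (_×_; _,_)
  open import Relation.Nullary using (Dec)
  open import Relation.Nullary.Decidable using (_×-dec_)
  open import Relation.Binary.PropositionalEquality hiding ([_])
  open ≡-Reasoning

  E : F → F × F → Set
  E c (v , z) = z * z ≡ (v * v - [ 4 ] * v) * (c - v)

  E? : ∀ c vz → Dec (E c vz)
  E? c (v , z) = z * z ≟F (v * v - [ 4 ] * v) * (c - v)

  #E : F → ℕ
  #E c = count (𝔽 ⊗ 𝔽) (E? c)

  -- Rescaling v by k² with k² c = 4 exchanges the roots 4 and c of the cubic.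
  RootSwap : F → F → F → Set
  RootSwap k c c′ = k * k * c ≡ [ 4 ] × c′ ≡ [ 4 ] * k * k

  scale : F → F × F → F × F
  scale k (v , z) = k * k * v , k * k * k * z

  scale∈E : ∀ {k c c′ vz} → RootSwap k c c′ → E c vz → E c′ (scale k vz)
  scale∈E {k} {c} {c′} {v , z} (k²c≡4 , c′≡4k²) z²≡ = begin
    k * k * k * z * (k * k * k * z)                   ≡⟨ solve 2 (λ k z → k :* k :* k :* z :* (k :* k :* k :* z)
                                                                := (k :* k) :* (k :* k) :* (k :* k) :* (z :* z)) refl k z ⟩
    s * s * s * (z * z)                               ≡⟨ cong (s * s * s *_) z²≡ ⟩
    s * s * s * ((v * v - [ 4 ] * v) * (c - v))       ≡⟨ solve 3 (λ s v c → s :* s :* s :* ((v :* v :- κ 4 :* v) :* (c :- v))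
                                                                := (s :* v :* (s :* v) :- s :* c :* (s :* v)) :* (κ 4 :* s :- s :* v))
                                                                refl s v c ⟩
    (V * V - s * c * V) * ([ 4 ] * s - V)             ≡⟨ cong₂ (λ a b → (V * V - a * V) * (b - V)) k²c≡4 (sym (trans c′≡4k² (*-assoc [ 4 ] k k))) ⟩
    (V * V - [ 4 ] * V) * (c′ - V)                    ∎
    where
    s V : F
    s = k * k
    V = k * k * v

  RootSwap-sym : ∀ {k c c′} → k ≢ 0# → RootSwap k c c′ → RootSwap (k ⁻¹) c′ c
  RootSwap-sym {k} {c} {c′} k≢0 (k²c≡4 , c′≡4k²) = (begin
    k ⁻¹ * k ⁻¹ * c′                        ≡⟨ cong (k ⁻¹ * k ⁻¹ *_) c′≡4k² ⟩
    k ⁻¹ * k ⁻¹ * ([ 4 ] * k * k)           ≡⟨ solve 2 (λ k u → u :* u :* (κ 4 :* k :* k) := κ 4 :* (k :* u) :* (k :* u)) refl k (k ⁻¹) ⟩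
    [ 4 ] * (k * k ⁻¹) * (k * k ⁻¹)         ≡⟨ cong (λ u → [ 4 ] * u * u) (*-inverseʳ k k≢0) ⟩
    [ 4 ] * 1# * 1#                         ≡⟨ solve 0 (κ 4 :* κ 1 :* κ 1 := κ 4) refl ⟩
    [ 4 ]                                   ∎) , (begin
    c                                       ≡⟨ solve 1 (λ c → c := κ 1 :* κ 1 :* c) refl c ⟩
    1# * 1# * c                             ≡⟨ cong (λ u → u * u * c) (*-inverseʳ k k≢0) ⟨
    (k * k ⁻¹) * (k * k ⁻¹) * c             ≡⟨ solve 3 (λ k u c → (k :* u) :* (k :* u) :* c := u :* u :* (k :* k :* c)) refl k (k ⁻¹) c ⟩
    k ⁻¹ * k ⁻¹ * (k * k * c)               ≡⟨ cong (k ⁻¹ * k ⁻¹ *_) k²c≡4 ⟩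
    k ⁻¹ * k ⁻¹ * [ 4 ]                     ≡⟨ solve 2 (λ u f → u :* u :* f := f :* u :* u) refl (k ⁻¹) [ 4 ] ⟩
    [ 4 ] * k ⁻¹ * k ⁻¹                     ∎)

  scale-scale : ∀ {k u} → k * u ≡ 1# → ∀ vz → scale u (scale k vz) ≡ vz
  scale-scale {k} {u} ku≡1 (v , z) = cong₂ _,_ (begin
    u * u * (k * k * v)                  ≡⟨ solve 3 (λ k u v → u :* u :* (k :* k :* v) := (k :* u) :* (k :* u) :* v) refl k u v ⟩
    (k * u) * (k * u) * v                ≡⟨ cong (λ a → a * a * v) ku≡1 ⟩
    1# * 1# * v                          ≡⟨ solve 1 (λ v → κ 1 :* κ 1 :* v := v) refl v ⟩
    v                                    ∎) (begin
    u * u * u * (k * k * k * z)          ≡⟨ solve 3 (λ k u z → u :* u :* u :* (k :* k :* k :* z) := (k :* u) :* (k :* u) :* (k :* u) :* z) refl k u z ⟩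
    (k * u) * (k * u) * (k * u) * z      ≡⟨ cong (λ a → a * a * a * z) ku≡1 ⟩
    1# * 1# * 1# * z                     ≡⟨ solve 1 (λ z → κ 1 :* κ 1 :* κ 1 :* z := z) refl z ⟩
    z                                    ∎)

  #E-RootSwap : ∀ {k c c′} → k ≢ 0# → RootSwap k c c′ → #E c ≡ #E c′
  #E-RootSwap {k} k≢0 swap = count-bijection (𝔽 ⊗ 𝔽) (𝔽 ⊗ 𝔽) (E? _) (E? _) (scale k) (scale (k ⁻¹))
    (λ _ → scale∈E swap) (λ _ → scale∈E (RootSwap-sym k≢0 swap))
    (λ vz _ → scale-scale (*-inverseʳ k k≢0) vz)
    (λ vz _ → scale-scale (trans (*-comm (k ⁻¹) k) (*-inverseʳ k k≢0)) vz)

  ConicPair : F → (F × F) × F → Set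
  ConicPair c ((v , w) , z) = Conic (v , w) × z * z ≡ c - v

  conicPair? : ∀ c vwz → Dec (ConicPair c vwz)
  conicPair? c ((v , w) , z) = conic? (v , w) ×-dec (z * z ≟F c - v)

  #ConicPair≡∑ : ∀ c → count ((𝔽 ⊗ 𝔽) ⊗ 𝔽) (conicPair? c) ≡ ∑ 𝔽 (λ v → roots (v * v - [ 4 ] * v) ℕ.* roots (c - v))
  #ConicPair≡∑ c = ∑-cong 𝔽 λ v → count-× 𝔽 𝔽 (λ w → conic? (v , w)) (λ z → z * z ≟F c - v)

  private
    cancel-counts : ∀ X M K P → M ℕ.+ 1 ≡ P → X ℕ.+ 2 ℕ.* P ≡ M ℕ.+ P ℕ.+ K → X ℕ.+ 1 ≡ K
    cancel-counts X M K _ refl e = ℕ.+-cancelʳ-≡ (M ℕ.+ (M ℕ.+ 1)) (X ℕ.+ 1) K (begin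
      X ℕ.+ 1 ℕ.+ (M ℕ.+ (M ℕ.+ 1))   ≡⟨ rearrange X M ⟩
      X ℕ.+ 2 ℕ.* (M ℕ.+ 1)           ≡⟨ e ⟩
      M ℕ.+ (M ℕ.+ 1) ℕ.+ K           ≡⟨ ℕ.+-comm _ K ⟩
      K ℕ.+ (M ℕ.+ (M ℕ.+ 1))         ∎)
      where
      open import Data.Nat.Tactic.RingSolver using (solve-∀)
      rearrange : ∀ X M → X ℕ.+ 1 ℕ.+ (M ℕ.+ (M ℕ.+ 1)) ≡ X ℕ.+ 2 ℕ.* (M ℕ.+ 1)
      rearrange = solve-∀

  -- Sum roots-* over v with a = v (v − 4) and b = c − v: the ∑ roots a count the conic and ∑ roots b = p.
  #ConicPair+1≡#E : ∀ c → count ((𝔽 ⊗ 𝔽) ⊗ 𝔽) (conicPair? c) ℕ.+ 1 ≡ #E c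
  #ConicPair+1≡#E c = cancel-counts _ (count (𝔽 ⊗ 𝔽) conic?) (#E c) p #Conic+1≡p (begin
    count ((𝔽 ⊗ 𝔽) ⊗ 𝔽) (conicPair? c) ℕ.+ 2 ℕ.* p
      ≡⟨ cong₂ ℕ._+_ (#ConicPair≡∑ c) (trans (cong (2 ℕ.*_) (sym ∑-𝔽-1)) (sym (∑-*ˡ 𝔽 2 (λ _ → 1)))) ⟩
    ∑ 𝔽 (λ v → roots (A v) ℕ.* roots (B v)) ℕ.+ ∑ 𝔽 (λ _ → 2)
      ≡⟨ ∑-+ 𝔽 _ _ ⟨
    ∑ 𝔽 (λ v → roots (A v) ℕ.* roots (B v) ℕ.+ 2)
      ≡⟨ ∑-cong 𝔽 (λ v → roots-* (A v) (B v)) ⟩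
    ∑ 𝔽 (λ v → roots (A v) ℕ.+ roots (B v) ℕ.+ roots (A v * B v))
      ≡⟨ trans (∑-+ 𝔽 _ _) (cong (ℕ._+ #E c) (∑-+ 𝔽 _ _)) ⟩
    ∑ 𝔽 (λ v → roots (A v)) ℕ.+ ∑ 𝔽 (λ v → roots (B v)) ℕ.+ #E c
      ≡⟨ cong (λ n → count (𝔽 ⊗ 𝔽) conic? ℕ.+ n ℕ.+ #E c) (∑-roots B B c-[c-v]≡v c-[c-v]≡v) ⟩
    count (𝔽 ⊗ 𝔽) conic? ℕ.+ p ℕ.+ #E c ∎)
    where
    A B : F → F
    A v = v * v - [ 4 ] * v
    B v = c - v
    c-[c-v]≡v : ∀ v → c - (c - v) ≡ v
    c-[c-v]≡v = solve 2 (λ c v → c :- (c :- v) := v) refl c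

module Solutions (p : ℕ) .{{_ : NonZero p}} (p-prime : Prime p) (p≢2 : p ≢ 2) where
  open EllipticCurve p p-prime p≢2 public
  open import Defs using (inv; N; IsSol; isSol?)
  open import Data.Fin using (toℕ; fromℕ<)
  open import Data.Nat.DivMod using (m%n<n)
  import Data.Nat as ℕ
  import Data.Nat.Properties as ℕ
  open import Data.Product using (_×_; _,_; proj₁; proj₂)
  open import Relation.Nullary using (Dec; ¬_)
  open import Relation.Nullary.Decidable using (_×-dec_; ¬?)
  open import Relation.Binary.PropositionalEquality hiding ([_])
  open ≡-Reasoning

  ℓ : F → F
  ℓ q = 1# + q ⁻¹

  sum-of-inverses : ∀ {x y} → x ≢ 0# → y ≢ 0# → x + x ⁻¹ + y + y ⁻¹ ≡ (x + y) * ℓ (x * y)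
  sum-of-inverses {x} {y} x≢0 y≢0 = begin
    x + x ⁻¹ + y + y ⁻¹                                  ≡⟨ solve 4 (λ x y u v → x :+ u :+ y :+ v := x :+ κ 1 :* u :+ y :+ κ 1 :* v) refl x y (x ⁻¹) (y ⁻¹) ⟩
    x + 1# * x ⁻¹ + y + 1# * y ⁻¹                        ≡⟨ cong₂ (λ a b → x + a * x ⁻¹ + y + b * y ⁻¹) (*-inverseʳ y y≢0) (*-inverseʳ x x≢0) ⟨
    x + (y * y ⁻¹) * x ⁻¹ + y + (x * x ⁻¹) * y ⁻¹        ≡⟨ solve 4 (λ x y u v → x :+ (y :* v) :* u :+ y :+ (x :* u) :* v := (x :+ y) :* (κ 1 :+ u :* v)) refl x y (x ⁻¹) (y ⁻¹) ⟩
    (x + y) * (1# + x ⁻¹ * y ⁻¹)                         ≡⟨ cong (λ u → (x + y) * (1# + u)) (⁻¹-* x≢0 y≢0) ⟨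
    (x + y) * ℓ (x * y)                                  ∎

  ℓ≡0⇒≡-1 : ∀ {q} → q ≢ 0# → ℓ q ≡ 0# → q ≡ - 1#
  ℓ≡0⇒≡-1 {q} q≢0 ℓq≡0 = x+y≡0⇒x≡-y (begin
    q + 1#                ≡⟨ cong (q +_) (*-inverseʳ q q≢0) ⟨
    q + q * q ⁻¹          ≡⟨ solve 2 (λ q r → q :+ q :* r := q :* (κ 1 :+ r)) refl q (q ⁻¹) ⟩
    q * ℓ q               ≡⟨ cong (q *_) ℓq≡0 ⟩
    q * 0#                ≡⟨ *-zeroʳ q ⟩
    0#                    ∎)

  ℓ-1≡0 : ℓ (- 1#) ≡ 0#
  ℓ-1≡0 = begin
    1# + (- 1#) ⁻¹        ≡⟨ cong (1# +_) (⁻¹-unique (solve 0 ((:- κ 1) :* (:- κ 1) := κ 1) refl)) ⟩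
    1# + - 1#             ≡⟨ -‿inverseʳ 1# ⟩
    0#                    ∎

  h≡ℓ²q : ∀ {q} → q ≢ 0# → h q ≡ ℓ q * ℓ q * q
  h≡ℓ²q {q} q≢0 = begin
    q + [ 2 ] + q ⁻¹                         ≡⟨ solve 2 (λ q r → q :+ κ 2 :+ r := q :+ κ 2 :* κ 1 :+ κ 1 :* r) refl q (q ⁻¹) ⟩
    q + [ 2 ] * 1# + 1# * q ⁻¹               ≡⟨ cong (λ u → q + [ 2 ] * u + u * q ⁻¹) (*-inverseʳ q q≢0) ⟨
    q + [ 2 ] * (q * q ⁻¹) + (q * q ⁻¹) * q ⁻¹ ≡⟨ solve 2 (λ q r → q :+ κ 2 :* (q :* r) :+ (q :* r) :* r := (κ 1 :+ r) :* (κ 1 :+ r) :* q) refl q (q ⁻¹) ⟩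
    ℓ q * ℓ q * q                            ∎

  Sol : F → F × F → Set
  Sol t (x , y) = x ≢ 0# × y ≢ 0# × x + x ⁻¹ + y + y ⁻¹ ≡ t

  sol? : ∀ t xy → Dec (Sol t xy)
  sol? t (x , y) = ¬? (x ≟F 0#) ×-dec ¬? (y ≟F 0#) ×-dec (x + x ⁻¹ + y + y ⁻¹ ≟F t)

  Quartic : F → F × F → Set
  Quartic c (q , z) = q ≢ 0# × z * z ≡ c - h q

  quartic? : ∀ c qz → Dec (Quartic c qz)
  quartic? c (q , z) = ¬? (q ≟F 0#) ×-dec (z * z ≟F c - h q)

  IsMinusOne : F × F → Set
  IsMinusOne (q , _) = q ≡ - 1#

  isMinusOne? : ∀ qz → Dec (IsMinusOne qz)
  isMinusOne? (q , _) = q ≟F - 1#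

  [_/2]² : F → F
  [ t /2]² = t * ½ * (t * ½)

  module _ {t : F} (t≢0 : t ≢ 0#) where

    toQuartic : F × F → F × F
    toQuartic (x , y) = x * y , ℓ (x * y) * (x - y) * ½

    fromQuartic : F × F → F × F
    fromQuartic (q , z) = (t * ½ + z) * ℓ q ⁻¹ , (t * ½ - z) * ℓ q ⁻¹

    module FromSol {x y : F} (sol : Sol t (x , y)) where
      x≢0 : x ≢ 0#
      x≢0 = proj₁ sol

      y≢0 : y ≢ 0#
      y≢0 = proj₁ (proj₂ sol)

      l : F
      l = ℓ (x * y)

      t≡[x+y]l : t ≡ (x + y) * l
      t≡[x+y]l = trans (sym (proj₂ (proj₂ sol))) (sum-of-inverses x≢0 y≢0)

      l≢0 : l ≢ 0#
      l≢0 l≡0 = t≢0 (trans t≡[x+y]l (trans (cong ((x + y) *_) l≡0) (*-zeroʳ (x + y))))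

      l*l⁻¹≡1 : l * l ⁻¹ ≡ 1#
      l*l⁻¹≡1 = *-inverseʳ l l≢0

      toQuartic∈ : Quartic [ t /2]² (toQuartic (x , y)) × ¬ IsMinusOne (toQuartic (x , y))
      toQuartic∈ = (*-≢0 x≢0 y≢0 , sym (begin
        t * ½ * (t * ½) - h (x * y)
          ≡⟨ cong₂ (λ u v → u * ½ * (u * ½) - v) t≡[x+y]l (h≡ℓ²q (*-≢0 x≢0 y≢0)) ⟩
        (x + y) * l * ½ * ((x + y) * l * ½) - l * l * (x * y)
          ≡⟨ solve 4 (λ x y l u → (x :+ y) :* l :* u :* ((x :+ y) :* l :* u) :- l :* l :* (x :* y)
                 := l :* (x :- y) :* u :* (l :* (x :- y) :* u) :+ l :* l :* (x :* y) :* ((κ 2 :* u) :* (κ 2 :* u) :- κ 1))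
                 refl x y l ½ ⟩
        z * z + l * l * (x * y) * (([ 2 ] * ½) * ([ 2 ] * ½) - 1#)
          ≡⟨ cong (λ u → z * z + l * l * (x * y) * (u * u - 1#)) 2*½≡1 ⟩
        z * z + l * l * (x * y) * (1# * 1# - 1#)
          ≡⟨ solve 2 (λ w e → w :+ e :* (κ 1 :* κ 1 :- κ 1) := w) refl (z * z) (l * l * (x * y)) ⟩
        z * z ∎)) , λ xy≡-1 → l≢0 (trans (cong ℓ xy≡-1) ℓ-1≡0)
        where
        z : F
        z = l * (x - y) * ½

      fromQuartic-toQuartic : fromQuartic (toQuartic (x , y)) ≡ (x , y)
      fromQuartic-toQuartic = cong₂ _,_ (begin
        (t * ½ + l * (x - y) * ½) * l ⁻¹
          ≡⟨ cong (λ u → (u * ½ + l * (x - y) * ½) * l ⁻¹) t≡[x+y]l ⟩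
        ((x + y) * l * ½ + l * (x - y) * ½) * l ⁻¹
          ≡⟨ solve 5 (λ x y l u m → ((x :+ y) :* l :* u :+ l :* (x :- y) :* u) :* m := κ 2 :* x :* u :* (l :* m)) refl x y l ½ (l ⁻¹) ⟩
        [ 2 ] * x * ½ * (l * l ⁻¹)
          ≡⟨ cong₂ _*_ (2*x*½≡x x) l*l⁻¹≡1 ⟩
        x * 1#
          ≡⟨ *-identityʳ x ⟩
        x ∎) (begin
        (t * ½ - l * (x - y) * ½) * l ⁻¹
          ≡⟨ cong (λ u → (u * ½ - l * (x - y) * ½) * l ⁻¹) t≡[x+y]l ⟩
        ((x + y) * l * ½ - l * (x - y) * ½) * l ⁻¹
          ≡⟨ solve 5 (λ x y l u m → ((x :+ y) :* l :* u :- l :* (x :- y) :* u) :* m := κ 2 :* y :* u :* (l :* m)) refl x y l ½ (l ⁻¹) ⟩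
        [ 2 ] * y * ½ * (l * l ⁻¹)
          ≡⟨ cong₂ _*_ (2*x*½≡x y) l*l⁻¹≡1 ⟩
        y * 1#
          ≡⟨ *-identityʳ y ⟩
        y ∎)

    module FromQuartic {q z : F} (quartic : Quartic [ t /2]² (q , z)) (q≢-1 : ¬ IsMinusOne (q , z)) where
      q≢0 : q ≢ 0#
      q≢0 = proj₁ quartic

      z²≡ : z * z ≡ [ t /2]² - h q
      z²≡ = proj₂ quartic

      l m X Y : F
      l = ℓ q
      m = l ⁻¹
      X = (t * ½ + z) * m
      Y = (t * ½ - z) * m

      l*m≡1 : l * m ≡ 1#
      l*m≡1 = *-inverseʳ l (λ l≡0 → q≢-1 (ℓ≡0⇒≡-1 q≢0 l≡0))

      X*Y≡q : X * Y ≡ q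
      X*Y≡q = begin
        (a + z) * m * ((a - z) * m)          ≡⟨ solve 3 (λ a z m → (a :+ z) :* m :* ((a :- z) :* m) := (a :* a :- z :* z) :* m :* m) refl a z m ⟩
        (a * a - z * z) * m * m              ≡⟨ cong (λ u → (a * a - u) * m * m) z²≡ ⟩
        (a * a - (a * a - h q)) * m * m      ≡⟨ cong (λ u → (a * a - (a * a - u)) * m * m) (h≡ℓ²q q≢0) ⟩
        (a * a - (a * a - l * l * q)) * m * m ≡⟨ solve 4 (λ a l q m → (a :* a :- (a :* a :- l :* l :* q)) :* m :* m := (l :* m) :* (l :* m) :* q) refl a l q m ⟩
        (l * m) * (l * m) * q                ≡⟨ cong (λ u → u * u * q) l*m≡1 ⟩
        1# * 1# * q                          ≡⟨ solve 1 (λ q → κ 1 :* κ 1 :* q := q) refl q ⟩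
        q                                    ∎
        where
        a : F
        a = t * ½

      X≢0 : X ≢ 0#
      X≢0 X≡0 = q≢0 (trans (sym X*Y≡q) (trans (cong (_* Y) X≡0) (trans (*-comm 0# Y) (*-zeroʳ Y))))

      Y≢0 : Y ≢ 0#
      Y≢0 Y≡0 = q≢0 (trans (sym X*Y≡q) (trans (cong (X *_) Y≡0) (*-zeroʳ X)))

      fromQuartic∈ : Sol t (fromQuartic (q , z))
      fromQuartic∈ = X≢0 , Y≢0 , (begin
        X + X ⁻¹ + Y + Y ⁻¹          ≡⟨ sum-of-inverses X≢0 Y≢0 ⟩
        (X + Y) * ℓ (X * Y)          ≡⟨ cong (λ u → (X + Y) * ℓ u) X*Y≡q ⟩
        (X + Y) * l                  ≡⟨ solve 5 (λ t z u l m → ((t :* u :+ z) :* m :+ (t :* u :- z) :* m) :* l := κ 2 :* t :* u :* (l :* m)) refl t z ½ l m ⟩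
        [ 2 ] * t * ½ * (l * m)      ≡⟨ cong₂ _*_ (2*x*½≡x t) l*m≡1 ⟩
        t * 1#                       ≡⟨ *-identityʳ t ⟩
        t                            ∎)

      toQuartic-fromQuartic : toQuartic (fromQuartic (q , z)) ≡ (q , z)
      toQuartic-fromQuartic = cong₂ _,_ X*Y≡q (begin
        ℓ (X * Y) * (X - Y) * ½      ≡⟨ cong (λ u → ℓ u * (X - Y) * ½) X*Y≡q ⟩
        l * (X - Y) * ½              ≡⟨ solve 5 (λ a z u l m → l :* ((a :+ z) :* m :- (a :- z) :* m) :* u := κ 2 :* z :* u :* (l :* m)) refl (t * ½) z ½ l m ⟩
        [ 2 ] * z * ½ * (l * m)      ≡⟨ cong₂ _*_ (2*x*½≡x z) l*m≡1 ⟩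
        z * 1#                       ≡⟨ *-identityʳ z ⟩
        z                            ∎)

  h-1≡0 : h (- 1#) ≡ 0#
  h-1≡0 = begin
    h (- 1#)                  ≡⟨ h≡ℓ²q -1≢0 ⟩
    ℓ (- 1#) * ℓ (- 1#) * - 1# ≡⟨ cong (λ u → u * u * - 1#) ℓ-1≡0 ⟩
    0# * 0# * - 1#            ≡⟨ solve 0 (κ 0 :* κ 0 :* (:- κ 1) := κ 0) refl ⟩
    0#                        ∎

  #Quartic-at-minus-one : ∀ c → count (𝔽 ⊗ 𝔽) (λ qz → quartic? c qz ×-dec isMinusOne? qz) ≡ roots c
  #Quartic-at-minus-one c = begin
    count (𝔽 ⊗ 𝔽) (λ qz → quartic? c qz ×-dec isMinusOne? qz)
      ≡⟨ count-⇔ (𝔽 ⊗ 𝔽) _ (λ (q , z) → (q ≟F - 1#) ×-dec (z * z ≟F c)) to from ⟩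
    count (𝔽 ⊗ 𝔽) (λ (q , z) → (q ≟F - 1#) ×-dec (z * z ≟F c))
      ≡⟨ count-× 𝔽 𝔽 (_≟F - 1#) (λ z → z * z ≟F c) ⟩
    count 𝔽 (_≟F - 1#) ℕ.* roots c
      ≡⟨ cong (ℕ._* roots c) (∑-𝟙-≡ 𝔽 (- 1#)) ⟩
    1 ℕ.* roots c
      ≡⟨ ℕ.*-identityˡ (roots c) ⟩
    roots c ∎
    where
    c-h-1≡c : c - h (- 1#) ≡ c
    c-h-1≡c = trans (cong (λ u → c - u) h-1≡0) (solve 1 (λ c → c :- κ 0 := c) refl c)
    to : ∀ qz → Quartic c qz × IsMinusOne qz → proj₁ qz ≡ - 1# × proj₂ qz * proj₂ qz ≡ c
    to (q , z) ((_ , z²≡) , refl) = refl , trans z²≡ c-h-1≡c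
    from : ∀ qz → proj₁ qz ≡ - 1# × proj₂ qz * proj₂ qz ≡ c → Quartic c qz × IsMinusOne qz
    from (q , z) (refl , z²≡c) = (-1≢0 , trans z²≡c (sym c-h-1≡c)) , refl

  #Quartic≡#ConicPair : ∀ c → count (𝔽 ⊗ 𝔽) (quartic? c) ≡ count ((𝔽 ⊗ 𝔽) ⊗ 𝔽) (conicPair? c)
  #Quartic≡#ConicPair c = count-bijection (𝔽 ⊗ 𝔽) ((𝔽 ⊗ 𝔽) ⊗ 𝔽) (quartic? c) (conicPair? c)
    (λ (q , z) → conic-point q , z) (λ (vw , z) → conic-parameter vw , z)
    (λ (q , z) (q≢0 , z²≡) → conic-point∈Conic q≢0 , z²≡)
    (λ (vw , z) (vw∈Conic , z²≡) → conic-parameter≢0 vw∈Conic ,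
      trans z²≡ (cong (λ u → c - u) (sym (cong proj₁ (conic-point-parameter vw∈Conic)))))
    (λ (q , z) _ → cong (_, z) (conic-parameter-point q))
    (λ (vw , z) (vw∈Conic , _) → cong (_, z) (conic-point-parameter vw∈Conic))

  #Sol+3≡#E : ∀ {t} → t ≢ 0# → count (𝔽 ⊗ 𝔽) (sol? t) ℕ.+ 3 ≡ #E [ t /2]²
  #Sol+3≡#E {t} t≢0 = begin
    count (𝔽 ⊗ 𝔽) (sol? t) ℕ.+ 3           ≡⟨ cong (ℕ._+ 3) #Sol≡#away ⟩
    #away ℕ.+ 3                             ≡⟨ trans (ℕ.+-comm #away 3) (cong (2 ℕ.+_) (ℕ.+-comm 1 #away)) ⟩
    2 ℕ.+ #away ℕ.+ 1                       ≡⟨ cong (λ n → n ℕ.+ #away ℕ.+ 1) roots-c≡2 ⟨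
    roots c ℕ.+ #away ℕ.+ 1                 ≡⟨ cong (λ n → n ℕ.+ #away ℕ.+ 1) (#Quartic-at-minus-one c) ⟨
    #at ℕ.+ #away ℕ.+ 1                     ≡⟨ cong (ℕ._+ 1) (count-split (𝔽 ⊗ 𝔽) (quartic? c) isMinusOne?) ⟨
    count (𝔽 ⊗ 𝔽) (quartic? c) ℕ.+ 1       ≡⟨ cong (ℕ._+ 1) (#Quartic≡#ConicPair c) ⟩
    count ((𝔽 ⊗ 𝔽) ⊗ 𝔽) (conicPair? c) ℕ.+ 1 ≡⟨ #ConicPair+1≡#E c ⟩
    #E c                                    ∎
    where
    c : F
    c = [ t /2]²
    #at #away : ℕ
    #at   = count (𝔽 ⊗ 𝔽) (λ qz → quartic? c qz ×-dec isMinusOne? qz)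
    #away = count (𝔽 ⊗ 𝔽) (λ qz → quartic? c qz ×-dec ¬? (isMinusOne? qz))
    roots-c≡2 : roots c ≡ 2
    roots-c≡2 = roots-square (*-≢0 t≢0 (⁻¹-≢0 2≢0))
    #Sol≡#away : count (𝔽 ⊗ 𝔽) (sol? t) ≡ #away
    #Sol≡#away = count-bijection (𝔽 ⊗ 𝔽) (𝔽 ⊗ 𝔽) (sol? t) _ (toQuartic t≢0) (fromQuartic t≢0)
      (λ _ sol → FromSol.toQuartic∈ t≢0 sol)
      (λ _ (∈Quartic , q≢-1) → FromQuartic.fromQuartic∈ t≢0 ∈Quartic q≢-1)
      (λ _ sol → FromSol.fromQuartic-toQuartic t≢0 sol)
      (λ _ (∈Quartic , q≢-1) → FromQuartic.toQuartic-fromQuartic t≢0 ∈Quartic q≢-1)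

  sum-of-inverses-toℕ : ∀ x y → x + x ⁻¹ + y + y ⁻¹ ≡ [ toℕ x ℕ.+ inv p (toℕ x) ℕ.+ toℕ y ℕ.+ inv p (toℕ y) ]
  sum-of-inverses-toℕ x y = begin
    x + x ⁻¹ + y + y ⁻¹                          ≡⟨ cong₂ (λ u v → u + x ⁻¹ + v + y ⁻¹) ([]-toℕ x) ([]-toℕ y) ⟨
    [ a ] + [ i ] + [ b ] + [ j ]                ≡⟨ cong (λ u → u + [ b ] + [ j ]) ([]-+ a i) ⟩
    [ a ℕ.+ i ] + [ b ] + [ j ]                  ≡⟨ cong (_+ [ j ]) ([]-+ (a ℕ.+ i) b) ⟩
    [ a ℕ.+ i ℕ.+ b ] + [ j ]                    ≡⟨ []-+ (a ℕ.+ i ℕ.+ b) j ⟩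
    [ a ℕ.+ i ℕ.+ b ℕ.+ j ]                      ∎
    where
    a b i j : ℕ
    a = toℕ x
    b = toℕ y
    i = inv p a
    j = inv p b

  N≡#Sol : ∀ t → N p t ≡ count (𝔽 ⊗ 𝔽) (sol? t)
  N≡#Sol t = trans (length-filter-allFin² (isSol? p (toℕ t))) (count-⇔ (𝔽 ⊗ 𝔽) _ (sol? t) to from)
    where
    to : ∀ xy → IsSol p (toℕ t) xy → Sol t xy
    to (x , y) (x≢0 , y≢0 , sum≡t) = toℕ≢0⇒≢0# x≢0 , toℕ≢0⇒≢0# y≢0 ,
      trans (sum-of-inverses-toℕ x y) (trans ([]-cong sum≡t) ([]-toℕ t))
    from : ∀ xy → Sol t xy → IsSol p (toℕ t) xy
    from (x , y) (x≢0 , y≢0 , sum≡t) = (λ x≡0 → x≢0 (toℕ≡0⇒≡0# x≡0)) , (λ y≡0 → y≢0 (toℕ≡0⇒≡0# y≡0)) ,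
      []-injective (trans (sym (sum-of-inverses-toℕ x y)) (trans sum≡t (sym ([]-toℕ t))))

  N+3≡#E : ∀ {t} → t ≢ 0# → N p t ℕ.+ 3 ≡ #E [ t /2]²
  N+3≡#E {t} t≢0 = trans (cong (ℕ._+ 3) (N≡#Sol t)) (#Sol+3≡#E t≢0)

  RootSwap-16/t : ∀ {t} → t ≢ 0# → RootSwap ([ 4 ] * t ⁻¹) [ t /2]² [ [ 16 ] * t ⁻¹ /2]²
  RootSwap-16/t {t} t≢0 = (begin
    [ 4 ] * u * ([ 4 ] * u) * (t * ½ * (t * ½))        ≡⟨ solve 3 (λ t u h → κ 4 :* u :* (κ 4 :* u) :* (t :* h :* (t :* h))
                                                                := κ 4 :* (t :* u) :* (t :* u) :* ((κ 2 :* h) :* (κ 2 :* h))) refl t u ½ ⟩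
    [ 4 ] * (t * u) * (t * u) * (([ 2 ] * ½) * ([ 2 ] * ½)) ≡⟨ cong₂ (λ a b → [ 4 ] * a * a * (b * b)) (*-inverseʳ t t≢0) 2*½≡1 ⟩
    [ 4 ] * 1# * 1# * (1# * 1#)                        ≡⟨ solve 0 (κ 4 :* κ 1 :* κ 1 :* (κ 1 :* κ 1) := κ 4) refl ⟩
    [ 4 ]                                              ∎) , (begin
    [ 16 ] * u * ½ * ([ 16 ] * u * ½)                  ≡⟨ solve 2 (λ u h → κ 16 :* u :* h :* (κ 16 :* u :* h)
                                                                := κ 4 :* (κ 4 :* u) :* (κ 4 :* u) :* ((κ 2 :* h) :* (κ 2 :* h))) refl u ½ ⟩
    [ 4 ] * ([ 4 ] * u) * ([ 4 ] * u) * (([ 2 ] * ½) * ([ 2 ] * ½)) ≡⟨ cong (λ b → [ 4 ] * ([ 4 ] * u) * ([ 4 ] * u) * (b * b)) 2*½≡1 ⟩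
    [ 4 ] * ([ 4 ] * u) * ([ 4 ] * u) * (1# * 1#)      ≡⟨ solve 2 (λ f k → f :* k :* k :* (κ 1 :* κ 1) := f :* k :* k) refl [ 4 ] ([ 4 ] * u) ⟩
    [ 4 ] * ([ 4 ] * u) * ([ 4 ] * u)                  ∎)
    where
    u : F
    u = t ⁻¹

  N[16/t]≡N[t] : ∀ {t} → t ≢ 0# → N p ([ 16 ] * t ⁻¹) ≡ N p t
  N[16/t]≡N[t] {t} t≢0 = ℕ.+-cancelʳ-≡ 3 _ _ (begin
    N p ([ 16 ] * t ⁻¹) ℕ.+ 3     ≡⟨ N+3≡#E (*-≢0 16≢0 (⁻¹-≢0 t≢0)) ⟩
    #E [ [ 16 ] * t ⁻¹ /2]²       ≡⟨ #E-RootSwap (*-≢0 4≢0 (⁻¹-≢0 t≢0)) (RootSwap-16/t t≢0) ⟨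
    #E [ t /2]²                   ≡⟨ N+3≡#E t≢0 ⟨
    N p t ℕ.+ 3                   ∎)

  fromℕ<-16*inv≡16/t : ∀ t → fromℕ< (m%n<n (16 ℕ.* inv p (toℕ t)) p) ≡ [ 16 ] * t ⁻¹
  fromℕ<-16*inv≡16/t t = trans (fromℕ<-%≡[] _) (sym ([]-* 16 (inv p (toℕ t))))

open import Defs using (N; inv)
open import Data.Nat using (_*_)
open import Data.Nat.DivMod using (m%n<n)
open import Data.Fin using (Fin; toℕ; fromℕ<)
open import Relation.Binary.PropositionalEquality using (trans; cong)

mainTheorem1 : (p : ℕ) .{{_ : NonZero p}} → Prime p → p ≢ 2 →
    (t : Fin p) → toℕ t ≢ 0 →
    N p (fromℕ< (m%n<n (16 * inv p (toℕ t)) p)) ≡ N p t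
mainTheorem1 p p-prime p≢2 t toℕt≢0 =
  trans (cong (N p) (fromℕ<-16*inv≡16/t t)) (N[16/t]≡N[t] (toℕ≢0⇒≢0# toℕt≢0))
  where open Solutions p p-prime p≢2 using (fromℕ<-16*inv≡16/t; N[16/t]≡N[t]; toℕ≢0⇒≢0#)
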